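{- Let $H$ be a Hadamard matrix of order $n$ with rows $r_1,\dots,r_n$, let $C_i=r_i^\top r_i$ ($1\le i\le n$) and $C_0=O_n$. Let $\ell$ be an odd integer with $1<\ell<n-1$, and suppose that $\sum_{i=1}^\ell C_i=\ell I_n+aA+b(J_n-A-I_n)$ for integers $a\neq b$ and a symmetric $(0,1)$-matrix $A$ with zero diagonal, and that $C_iJ_n=O_n$ for $i=1,\dots,\ell$. Let $L=(L_{i,j})_{i,j=1}^{\ell+1}$ be a symmetric Latin square of order $\ell+1$ on the symbol set $\{0,1,\dots,\ell\}$ with all diagonal entries equal to $0$, and let $\bar L=(\epsilon_{i,j}C_{L_{i,j}})_{i,j=1}^{\ell+1}$ (a block matrix), where $\epsilon_{i,j}=1$ if $i\le j$ and $\epsilon_{i,j}=-1$ if $i>j$. Define $A_0=I_{(\ell+1)n}$, $A_1=I_{\ell+1}\otimes A$, $A_2=I_{\ell+1}\otimes(J_n-A-I_n)$, and let $A_3,A_4$ be the $(0,1)$-matrices with disjoint supports such that $\bar L=A_3-A_4$. Then $\{A_0,A_1,A_2,A_3,A_4\}$ is a non-symmetric association scheme with $4$ classes.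
   Context: A Hadamard matrix of order $n$ is an $n\times n$ $\{1,-1\}$-matrix $H$ with $HH^\top=nI_n$; $J_n$ is the all-ones and $O_n$ the zero matrix. A $d$-class commutative association scheme on a finite set $X$ is a set of nonzero $(0,1)$-matrices $A_0,\dots,A_d$ indexed by $X$ with $A_0=I$, $\sum_i A_i=J$, each $A_i^\top\in\{A_0,\dots,A_d\}$ (with $A_i^\top\ne A_0$ for $i\ge1$), $A_iA_j=\sum_k p_{i,j}^kA_k$ for nonnegative integers $p_{i,j}^k$, and $A_iA_j=A_jA_i$; it is symmetric if all $A_i$ are symmetric, non-symmetric otherwise. -}

module Defs where

open import Data.Nat as ℕ using (ℕ; zero; suc; _<?_)
open import Data.Integer as ℤ using (ℤ; +_; -_; _*_; _+_; _-_; 0ℤ; 1ℤ; -1ℤ)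
open import Data.Fin as Fin using (Fin; zero; suc; toℕ; fromℕ<; remQuot)
open import Data.Product using (_×_; _,_; ∃; Σ; proj₁; proj₂)
open import Data.Sum using (_⊎_)
open import Relation.Binary.PropositionalEquality using (_≡_; _≢_)
open import Relation.Nullary using (¬_; yes; no)
open import Function.Definitions using (Injective)

Mat : ℕ → ℕ → Set
Mat m n = Fin m → Fin n → ℤ

sumℤ : ∀ {n} → (Fin n → ℤ) → ℤ
sumℤ {zero}  f = 0ℤ
sumℤ {suc n} f = f zero + sumℤ (λ i → f (suc i))

_≐_ : ∀ {m n} → Mat m n → Mat m n → Set
M ≐ N = ∀ x y → M x y ≡ N x y
infix 4 _≐_

_·_ : ∀ {m k n} → Mat m k → Mat k n → Mat m n
(M · N) x y = sumℤ (λ z → M x z * N z y)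
infixl 7 _·_

_ᵀ : ∀ {m n} → Mat m n → Mat n m
(M ᵀ) x y = M y x

I : ∀ {n} → Mat n n
I x y with x Fin.≟ y
... | yes _ = 1ℤ
... | no  _ = 0ℤ

J : ∀ {m n} → Mat m n
J _ _ = 1ℤ

O : ∀ {m n} → Mat m n
O _ _ = 0ℤ

_⊕_ : ∀ {m n} → Mat m n → Mat m n → Mat m n
(M ⊕ N) x y = M x y + N x y

_⊖_ : ∀ {m n} → Mat m n → Mat m n → Mat m n
(M ⊖ N) x y = M x y - N x y

_⊙_ : ∀ {m n} → ℤ → Mat m n → Mat m n
(c ⊙ M) x y = c * M x y

Symmetric : ∀ {n} → Mat n n → Set
Symmetric M = M ᵀ ≐ M

Is01 : ∀ {m n} → Mat m n → Set
Is01 M = ∀ x y → M x y ≡ 0ℤ ⊎ M x y ≡ 1ℤ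

IsHadamard : ∀ {n} → Mat n n → Set
IsHadamard {n} H = (∀ x y → H x y ≡ 1ℤ ⊎ H x y ≡ -1ℤ) × (H · H ᵀ ≐ (+ n) ⊙ I)

-- C_i = r_iᵀ r_i (rows numbered 1..n), C_0 = O.
-- Indices beyond n are given the (irrelevant) value O.
C : ∀ {n} → Mat n n → ℕ → Mat n n
C H zero = O
C {n} H (suc k) with k <? n
... | yes p = λ x y → H (fromℕ< p) x * H (fromℕ< p) y
... | no  _ = O

ε : ∀ {m} → Fin m → Fin m → ℤ
ε i j with toℕ i ℕ.≤? toℕ j
... | yes _ = 1ℤ
... | no  _ = -1ℤ

-- Latin square of order m on symbols Fin m (each symbol at most, hence
-- exactly, once in each row and each column)
IsLatinSquare : ∀ {m} → (Fin m → Fin m → Fin m) → Set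
IsLatinSquare L = (∀ i → Injective _≡_ _≡_ (L i)) × (∀ j → Injective _≡_ _≡_ (λ i → L i j))

-- Block matrices of order (k * n), row index p ↦ (block, inner) = remQuot n p
-- I_k ⊗ M
IKron : ∀ k {n} → Mat n n → Mat (k ℕ.* n) (k ℕ.* n)
IKron k {n} M p q with remQuot {k} n p | remQuot {k} n q
... | (i , x) | (j , y) with i Fin.≟ j
...   | yes _ = M x y
...   | no  _ = 0ℤ

Block : ∀ {k n} → (Fin k → Fin k → Mat n n) → Mat (k ℕ.* n) (k ℕ.* n)
Block {k} {n} B p q with remQuot {k} n p | remQuot {k} n q
... | (i , x) | (j , y) = B i j x y

Lbar : ∀ {ℓ n} → Mat n n → (Fin (suc ℓ) → Fin (suc ℓ) → Fin (suc ℓ))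
     → Mat (suc ℓ ℕ.* n) (suc ℓ ℕ.* n)
Lbar H L = Block (λ i j → ε i j ⊙ C H (toℕ (L i j)))

IsAssocScheme : ∀ {N} d → (Fin (suc d) → Mat N N) → Set
IsAssocScheme {N} d A =
    (∀ i → Is01 (A i))
  × (∀ i → ∃ λ x → ∃ λ y → A i x y ≡ 1ℤ)
  × (A zero ≐ I)
  × ((λ x y → sumℤ (λ i → A i x y)) ≐ J)
  × (∀ i → ∃ λ j → A i ᵀ ≐ A j)
  × (∀ (i : Fin d) → ¬ (A (suc i) ᵀ ≐ I))
  × (∀ i j → ∃ λ (p : Fin (suc d) → ℕ) →
        A i · A j ≐ (λ x y → sumℤ (λ k → (+ p k) * A k x y)))
  × (∀ i j → A i · A j ≐ A j · A i)

NonSymmetric : ∀ {N d} → (Fin (suc d) → Mat N N) → Set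
NonSymmetric A = ∃ λ i → ¬ Symmetric (A i)

fam5 : ∀ {N} → Mat N N → Mat N N → Mat N N → Mat N N → Mat N N → Fin 5 → Mat N N
fam5 A0 A1 A2 A3 A4 zero = A0
fam5 A0 A1 A2 A3 A4 (suc zero) = A1
fam5 A0 A1 A2 A3 A4 (suc (suc zero)) = A2
fam5 A0 A1 A2 A3 A4 (suc (suc (suc zero))) = A3
fam5 A0 A1 A2 A3 A4 (suc (suc (suc (suc zero)))) = A4

module Submission where

-- Idea. Put S = C₁ + ⋯ + C_ℓ. The five matrices I, I ⊗ S, I ⊗ J, J, L̄
-- multiply among themselves to multiples of one another (the rows of H are
-- orthogonal, the Cᵢ have zero row sums, L is a Latin square and ε is
-- antisymmetric), with a symmetric multiplication table, so their integer
-- span is a commutative algebra. Each generator is an integer combination of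
-- the classes Aₖ, and e Aₖ lies in the span for e = 2(a − b) ≠ 0. Hence
-- e² AᵢAⱼ is a combination of the classes; as the classes partition J and
-- AᵢAⱼ has natural entries, AᵢAⱼ is a combination with natural coefficients,
-- and cancelling e² gives AᵢAⱼ = AⱼAᵢ. The remaining axioms are checked
-- directly; that A and J − A − I are nonzero follows from the zero row sums of
-- S and 0 < ℓ < n − 1.

module Construction where

  open import Defs
  open import Data.Nat as ℕ using (ℕ; zero; suc; _<?_; _∸_)
  import Data.Nat.Properties as ℕP
  open import Data.Nat.Divisibility using (divides; >⇒∤)
  open import Data.Integer as ℤ using (ℤ; +_; -_; _*_; _+_; _-_; 0ℤ; 1ℤ; -1ℤ; ∣_∣)
  import Data.Integer.Properties as ℤP
  open import Data.Integer.Tactic.RingSolver using (solve-∀)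
  open import Data.Fin as Fin
    using (Fin; zero; suc; toℕ; fromℕ<; _↑ˡ_; _↑ʳ_; combine; remQuot; punchIn; punchOut)
  open import Data.Fin.Patterns using (0F; 1F; 2F; 3F; 4F)
  import Data.Fin.Properties as FinP
  open import Data.Product using (_×_; _,_; Σ; proj₁; proj₂)
  open import Data.Sum using (_⊎_; inj₁; inj₂)
  open import Data.Empty using (⊥-elim)
  open import Function.Definitions using (Injective)
  open import Relation.Binary.PropositionalEquality hiding (J)
  open import Relation.Nullary using (¬_; yes; no; Dec)
  open import Algebra.Properties.Semiring.Sum ℤP.+-*-semiring
    using (sum; sum-cong-≗; ∑-distrib-+; ∑-comm; *-distribˡ-sum; sum-remove)
  open import Algebra.Properties.AbelianGroup ℤP.+-0-abelianGroup
    using () renaming (∙-cancelˡ to +-cancelˡ)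
  open import Algebra.Properties.CommutativeSemigroup ℤP.*-commutativeSemigroup
    using () renaming (x∙yz≈y∙xz to *-left-comm)
  open ≡-Reasoning

  sumℤ≡sum : ∀ {n} (f : Fin n → ℤ) → sumℤ f ≡ sum f
  sumℤ≡sum {zero}  f = refl
  sumℤ≡sum {suc n} f = cong (_+_ (f zero)) (sumℤ≡sum (λ i → f (suc i)))

  sum-cong : ∀ {n} {f g : Fin n → ℤ} → (∀ i → f i ≡ g i) → sumℤ f ≡ sumℤ g
  sum-cong {f = f} {g} e = begin
    sumℤ f ≡⟨ sumℤ≡sum f ⟩ sum f ≡⟨ sum-cong-≗ e ⟩ sum g ≡⟨ sumℤ≡sum g ⟨ sumℤ g ∎

  sum-+ : ∀ {n} (f g : Fin n → ℤ) → sumℤ (λ i → f i + g i) ≡ sumℤ f + sumℤ g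
  sum-+ f g = begin
    sumℤ (λ i → f i + g i) ≡⟨ sumℤ≡sum (λ i → f i + g i) ⟩
    sum (λ i → f i + g i)  ≡⟨ ∑-distrib-+ f g ⟩
    sum f + sum g          ≡⟨ cong₂ _+_ (sumℤ≡sum f) (sumℤ≡sum g) ⟨
    sumℤ f + sumℤ g        ∎

  sum-*ˡ : ∀ {n} (c : ℤ) (f : Fin n → ℤ) → sumℤ (λ i → c * f i) ≡ c * sumℤ f
  sum-*ˡ c f = begin
    sumℤ (λ i → c * f i) ≡⟨ sumℤ≡sum (λ i → c * f i) ⟩
    sum (λ i → c * f i)  ≡⟨ *-distribˡ-sum c f ⟨
    c * sum f            ≡⟨ cong (c *_) (sumℤ≡sum f) ⟨
    c * sumℤ f           ∎

  sum-*ʳ : ∀ {n} (c : ℤ) (f : Fin n → ℤ) → sumℤ (λ i → f i * c) ≡ sumℤ f * c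
  sum-*ʳ c f = trans (sum-cong (λ i → ℤP.*-comm (f i) c)) (trans (sum-*ˡ c f) (ℤP.*-comm c _))

  sum-const : ∀ n (c : ℤ) → sumℤ {n} (λ _ → c) ≡ + n * c
  sum-const zero c = sym (ℤP.*-zeroˡ c)
  sum-const (suc n) c = trans (cong (_+_ c) (sum-const n c)) (lem c (+ n))
    where lem : ∀ c n → c + n * c ≡ (1ℤ + n) * c
          lem = solve-∀

  sum-zero : ∀ {n} (f : Fin n → ℤ) → (∀ i → f i ≡ 0ℤ) → sumℤ f ≡ 0ℤ
  sum-zero {n} f e = trans (sum-cong e) (trans (sum-const n 0ℤ) (ℤP.*-zeroʳ (+ n)))

  sum-swap : ∀ {m n} (f : Fin m → Fin n → ℤ) →
    sumℤ (λ i → sumℤ (λ j → f i j)) ≡ sumℤ (λ j → sumℤ (λ i → f i j))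
  sum-swap f = begin
    sumℤ (λ i → sumℤ (f i))            ≡⟨ double f ⟩
    sum (λ i → sum (f i))              ≡⟨ ∑-comm f ⟩
    sum (λ j → sum (λ i → f i j))      ≡⟨ double (λ j i → f i j) ⟨
    sumℤ (λ j → sumℤ (λ i → f i j))    ∎
    where
    double : ∀ {m n} (g : Fin m → Fin n → ℤ) → sumℤ (λ i → sumℤ (g i)) ≡ sum (λ i → sum (g i))
    double g = trans (sumℤ≡sum (λ i → sumℤ (g i))) (sum-cong-≗ (λ i → sumℤ≡sum (g i)))


  sum-product : ∀ {m n} (f : Fin m → ℤ) (g : Fin n → ℤ) →
    sumℤ f * sumℤ g ≡ sumℤ (λ i → sumℤ (λ j → f i * g j))
  sum-product f g = trans (sym (sum-*ʳ (sumℤ g) f)) (sum-cong (λ i → sym (sum-*ˡ (f i) g)))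

  sum-remove-at : ∀ {n} (j : Fin (suc n)) (f : Fin (suc n) → ℤ) →
    sumℤ f ≡ f j + sumℤ (λ i → f (punchIn j i))
  sum-remove-at j f = begin
    sumℤ f                              ≡⟨ sumℤ≡sum f ⟩
    sum f                               ≡⟨ sum-remove {i = j} f ⟩
    f j + sum (λ i → f (punchIn j i))   ≡⟨ cong (_+_ (f j)) (sumℤ≡sum (λ i → f (punchIn j i))) ⟨
    f j + sumℤ (λ i → f (punchIn j i))  ∎

  sum-reindex : ∀ {n} (g : Fin n → Fin n) → Injective _≡_ _≡_ g → (f : Fin n → ℤ) →
    sumℤ (λ i → f (g i)) ≡ sumℤ f
  sum-reindex {zero}  g inj f = refl
  sum-reindex {suc n} g inj f = begin
    f (g zero) + sumℤ (λ i → f (g (suc i)))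
      ≡⟨ cong (_+_ (f (g zero))) (sum-cong (λ i → cong f (sym (FinP.punchIn-punchOut (g₀≢ i))))) ⟩
    f (g zero) + sumℤ (λ i → f (punchIn (g zero) (g′ i)))
      ≡⟨ cong (_+_ (f (g zero))) (sum-reindex g′ g′-injective (λ i → f (punchIn (g zero) i))) ⟩
    f (g zero) + sumℤ (λ i → f (punchIn (g zero) i))
      ≡⟨ sum-remove-at (g zero) f ⟨
    sumℤ f ∎
    where
    g₀≢ : ∀ i → g zero ≢ g (suc i)
    g₀≢ i e with () ← inj e
    -- g restricted to the indices ≠ 0, with the value g 0 removed from its range
    g′ : Fin n → Fin n
    g′ i = punchOut (g₀≢ i)
    g′-injective : Injective _≡_ _≡_ g′
    g′-injective {i} {j} e = FinP.suc-injective (inj (FinP.punchOut-injective (g₀≢ i) (g₀≢ j) e))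

  sum-blocks : ∀ k n (f : Fin (k ℕ.* n) → ℤ) →
    sumℤ f ≡ sumℤ (λ (i : Fin k) → sumℤ (λ (x : Fin n) → f (combine i x)))
  sum-blocks zero    n f = refl
  sum-blocks (suc k) n f = trans (sum-split n (k ℕ.* n) f)
    (cong (_+_ (sumℤ (λ x → f (x ↑ˡ (k ℕ.* n))))) (sum-blocks k n (λ q → f (n ↑ʳ q))))
    where
    sum-split : ∀ m p (g : Fin (m ℕ.+ p) → ℤ) →
      sumℤ g ≡ sumℤ (λ i → g (i ↑ˡ p)) + sumℤ (λ j → g (m ↑ʳ j))
    sum-split zero    p g = sym (ℤP.+-identityˡ _)
    sum-split (suc m) p g = trans (cong (_+_ (g zero)) (sum-split m p (λ i → g (suc i))))
                                  (sym (ℤP.+-assoc (g zero) _ _))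

  I-refl : ∀ {n} (i : Fin n) → I i i ≡ 1ℤ
  I-refl i with i Fin.≟ i
  ... | yes _  = refl
  ... | no i≢i = ⊥-elim (i≢i refl)

  I-≢ : ∀ {n} {i j : Fin n} → i ≢ j → I i j ≡ 0ℤ
  I-≢ {i = i} {j} i≢j with i Fin.≟ j
  ... | yes i≡j = ⊥-elim (i≢j i≡j)
  ... | no _    = refl

  I-sym : ∀ {n} (i j : Fin n) → I i j ≡ I j i
  I-sym i j with i Fin.≟ j
  ... | yes refl = sym (I-refl i)
  ... | no i≢j   = sym (I-≢ (λ e → i≢j (sym e)))

  I-injective : ∀ {m n} {f : Fin m → Fin n} → Injective _≡_ _≡_ f → ∀ i j → I (f i) (f j) ≡ I i j
  I-injective {f = f} inj i j with i Fin.≟ j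
  ... | yes refl = I-refl (f i)
  ... | no i≢j   = I-≢ (λ e → i≢j (inj e))

  I-01 : ∀ {n} (i j : Fin n) → I i j ≡ 0ℤ ⊎ I i j ≡ 1ℤ
  I-01 i j with i Fin.≟ j
  ... | yes _ = inj₂ refl
  ... | no _  = inj₁ refl

  I≡1⇒≡ : ∀ {n} {i j : Fin n} → I i j ≡ 1ℤ → i ≡ j
  I≡1⇒≡ {i = i} {j} e with i Fin.≟ j
  ... | yes i≡j = i≡j
  I≡1⇒≡ () | no _

  sum-δ : ∀ {n} (i : Fin n) (f : Fin n → ℤ) → sumℤ (λ j → I i j * f j) ≡ f i
  sum-δ {suc n} i f = begin
    sumℤ (λ j → I i j * f j)
      ≡⟨ sum-remove-at i (λ j → I i j * f j) ⟩
    I i i * f i + sumℤ (λ j → I i (punchIn i j) * f (punchIn i j))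
      ≡⟨ cong₂ _+_ (cong (_* f i) (I-refl i))
                   (sum-zero _ (λ j → cong (_* f (punchIn i j)) (I-≢ (λ e → FinP.punchInᵢ≢i i j (sym e))))) ⟩
    1ℤ * f i + 0ℤ
      ≡⟨ trans (ℤP.+-identityʳ _) (ℤP.*-identityˡ (f i)) ⟩
    f i ∎

  sum-δ′ : ∀ {n} (i : Fin n) (f : Fin n → ℤ) → sumℤ (λ j → f j * I j i) ≡ f i
  sum-δ′ i f = trans (sum-cong (λ j → trans (ℤP.*-comm (f j) (I j i)) (cong (_* f j) (I-sym j i)))) (sum-δ i f)

  ≐-sym : ∀ {m n} {M K : Mat m n} → M ≐ K → K ≐ M
  ≐-sym e x y = sym (e x y)

  ≐-trans : ∀ {m n} {M K P : Mat m n} → M ≐ K → K ≐ P → M ≐ P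
  ≐-trans e f x y = trans (e x y) (f x y)

  ·-cong : ∀ {m k n} {M M′ : Mat m k} {K K′ : Mat k n} → M ≐ M′ → K ≐ K′ → M · K ≐ M′ · K′
  ·-cong e f x y = sum-cong (λ z → cong₂ _*_ (e x z) (f z y))

  ·-congˡ : ∀ {m k n} {M M′ : Mat m k} (K : Mat k n) → M ≐ M′ → M · K ≐ M′ · K
  ·-congˡ K e x y = sum-cong (λ z → cong (_* K z y) (e x z))

  ·-congʳ : ∀ {m k n} (M : Mat m k) {K K′ : Mat k n} → K ≐ K′ → M · K ≐ M · K′
  ·-congʳ M e x y = sum-cong (λ z → cong (M x z *_) (e z y))

  O-· : ∀ {m k n} (M : Mat k n) → O {m} {k} · M ≐ O
  O-· M x y = sum-zero (λ z → 0ℤ * M z y) (λ z → refl)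

  ·-O : ∀ {m k n} (M : Mat m k) → M · O {k} {n} ≐ O
  ·-O M x y = sum-zero (λ z → M x z * 0ℤ) (λ z → ℤP.*-zeroʳ (M x z))

  I-· : ∀ {m n} (M : Mat m n) → I · M ≐ M
  I-· M x y = sum-δ x (λ z → M z y)

  ·-I : ∀ {m n} (M : Mat m n) → M · I ≐ M
  ·-I M x y = sum-δ′ y (λ z → M x z)

  ⊙-·-⊙ : ∀ {m k n} (c d : ℤ) (M : Mat m k) (K : Mat k n) → (c ⊙ M) · (d ⊙ K) ≐ (c * d) ⊙ (M · K)
  ⊙-·-⊙ c d M K x y = trans (sum-cong (λ z → lem c d (M x z) (K z y))) (sum-*ˡ (c * d) (λ z → M x z * K z y))
    where lem : ∀ c d m k → c * m * (d * k) ≡ c * d * (m * k)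
          lem = solve-∀

  ⊙-· : ∀ {m k n} (c : ℤ) (M : Mat m k) (K : Mat k n) → (c ⊙ M) · K ≐ c ⊙ (M · K)
  ⊙-· c M K x y = trans (sum-cong (λ z → ℤP.*-assoc c (M x z) (K z y))) (sum-*ˡ c (λ z → M x z * K z y))

  ·-⊙ : ∀ {m k n} (c : ℤ) (M : Mat m k) (K : Mat k n) → M · (c ⊙ K) ≐ c ⊙ (M · K)
  ·-⊙ c M K x y = trans (sum-cong (λ z → *-left-comm (M x z) c (K z y))) (sum-*ˡ c (λ z → M x z * K z y))

  sum-· : ∀ {r m k n} (F : Fin r → Mat m k) (K : Mat k n) →
    (λ x y → sumℤ (λ a → F a x y)) · K ≐ (λ x y → sumℤ (λ a → (F a · K) x y))
  sum-· F K x y = trans (sum-cong (λ z → sym (sum-*ʳ (K z y) (λ a → F a x z))))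
                        (sym (sum-swap (λ a z → F a x z * K z y)))

  ·-sum : ∀ {r m k n} (K : Mat m k) (F : Fin r → Mat k n) →
    K · (λ x y → sumℤ (λ a → F a x y)) ≐ (λ x y → sumℤ (λ a → (K · F a) x y))
  ·-sum K F x y = trans (sum-cong (λ z → sym (sum-*ˡ (K x z) (λ a → F a z y))))
                        (sym (sum-swap (λ a z → K x z * F a z y)))

  lincomb : ∀ {r N} → (Fin r → ℤ) → (Fin r → Mat N N) → Mat N N
  lincomb c F x y = sumℤ (λ a → c a * F a x y)

  lincomb-· : ∀ {r N} (u v : Fin r → ℤ) (F : Fin r → Mat N N) →
    lincomb u F · lincomb v F ≐ (λ x y → sumℤ (λ a → sumℤ (λ b → (u a * v b) * (F a · F b) x y)))
  lincomb-· u v F x y = begin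
    sumℤ (λ z → sumℤ (λ a → u a * F a x z) * sumℤ (λ b → v b * F b z y))
      ≡⟨ sum-cong (λ z → sum-product (λ a → u a * F a x z) (λ b → v b * F b z y)) ⟩
    sumℤ (λ z → sumℤ (λ a → sumℤ (λ b → (u a * F a x z) * (v b * F b z y))))
      ≡⟨ sum-swap (λ z a → sumℤ (λ b → (u a * F a x z) * (v b * F b z y))) ⟩
    sumℤ (λ a → sumℤ (λ z → sumℤ (λ b → (u a * F a x z) * (v b * F b z y))))
      ≡⟨ sum-cong (λ a → sum-swap (λ z b → (u a * F a x z) * (v b * F b z y))) ⟩
    sumℤ (λ a → sumℤ (λ b → sumℤ (λ z → (u a * F a x z) * (v b * F b z y))))
      ≡⟨ sum-cong (λ a → sum-cong (λ b → ⊙-·-⊙ (u a) (v b) (F a) (F b) x y)) ⟩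
    sumℤ (λ a → sumℤ (λ b → (u a * v b) * (F a · F b) x y)) ∎

  record InSpan {r N} (F : Fin r → Mat N N) (M : Mat N N) : Set where
    constructor span
    field
      coefficients : Fin r → ℤ
      expansion    : M ≐ lincomb coefficients F

  module _ {r N} {F : Fin r → Mat N N} where

    span-≐ : ∀ {M M′} → M ≐ M′ → InSpan F M → InSpan F M′
    span-≐ e (span c f) = span c (≐-trans (≐-sym e) f)

    span-⊕ : ∀ {M M′} → InSpan F M → InSpan F M′ → InSpan F (M ⊕ M′)
    span-⊕ (span c f) (span c′ f′) = span (λ a → c a + c′ a) λ x y → begin
      _ ≡⟨ cong₂ _+_ (f x y) (f′ x y) ⟩
      sumℤ (λ a → c a * F a x y) + sumℤ (λ a → c′ a * F a x y)
        ≡⟨ sum-+ (λ a → c a * F a x y) (λ a → c′ a * F a x y) ⟨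
      sumℤ (λ a → c a * F a x y + c′ a * F a x y)
        ≡⟨ sum-cong (λ a → ℤP.*-distribʳ-+ (F a x y) (c a) (c′ a)) ⟨
      _ ∎

    span-⊙ : ∀ d {M} → InSpan F M → InSpan F (d ⊙ M)
    span-⊙ d (span c f) = span (λ a → d * c a) λ x y →
      trans (cong (d *_) (f x y))
            (trans (sym (sum-*ˡ d (λ a → c a * F a x y))) (sum-cong (λ a → sym (ℤP.*-assoc d (c a) _))))

    span-O : InSpan F O
    span-O = span (λ _ → 0ℤ) λ x y → sym (sum-zero (λ a → 0ℤ * F a x y) (λ _ → refl))

    span-sum : ∀ {m} (M : Fin m → Mat N N) → (∀ i → InSpan F (M i)) →
      InSpan F (λ x y → sumℤ (λ i → M i x y))
    span-sum {zero}  M h = span-O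
    span-sum {suc m} M h = span-⊕ (h zero) (span-sum (λ i → M (suc i)) (λ i → h (suc i)))

    span-member : ∀ a → InSpan F (F a)
    span-member a = span (I a) λ x y → sym (sum-δ a (λ b → F b x y))

  span-mono : ∀ {r s N} {G : Fin r → Mat N N} {A : Fin s → Mat N N} →
    (∀ a → InSpan A (G a)) → ∀ {M} → InSpan G M → InSpan A M
  span-mono {G = G} G⊆A (span c f) =
    span-≐ (≐-sym f) (span-sum (λ a → c a ⊙ G a) (λ a → span-⊙ (c a) (G⊆A a)))

  span-· : ∀ {r s N} {G : Fin r → Mat N N} {A : Fin s → Mat N N} →
    (∀ a b → InSpan A (G a · G b)) → ∀ {M K} → InSpan G M → InSpan G K → InSpan A (M · K)
  span-· {G = G} GG⊆A (span u f) (span v h) =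
    span-≐ (≐-sym (≐-trans (·-cong f h) (lincomb-· u v G)))
      (span-sum _ (λ a → span-sum _ (λ b → span-⊙ (u a * v b) (GG⊆A a b))))

  span-comm : ∀ {r N} {G : Fin r → Mat N N} →
    (∀ a b → G a · G b ≐ G b · G a) → ∀ {M K} → InSpan G M → InSpan G K → M · K ≐ K · M
  span-comm {G = G} comm {M} {K} (span u f) (span v h) x y = begin
    (M · K) x y
      ≡⟨ ≐-trans (·-cong f h) (lincomb-· u v G) x y ⟩
    sumℤ (λ a → sumℤ (λ b → (u a * v b) * (G a · G b) x y))
      ≡⟨ sum-cong (λ a → sum-cong (λ b → cong₂ _*_ (ℤP.*-comm (u a) (v b)) (comm a b x y))) ⟩
    sumℤ (λ a → sumℤ (λ b → (v b * u a) * (G b · G a) x y))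
      ≡⟨ sum-swap (λ a b → (v b * u a) * (G b · G a) x y) ⟩
    sumℤ (λ b → sumℤ (λ a → (v b * u a) * (G b · G a) x y))
      ≡⟨ ≐-trans (·-cong h f) (lincomb-· v u G) x y ⟨
    (K · M) x y ∎

  Bit : ℤ → Set
  Bit u = u ≡ 0ℤ ⊎ u ≡ 1ℤ

  Natural : ℤ → Set
  Natural u = Σ ℕ λ t → u ≡ + t

  bit-* : ∀ {u v} → Bit u → Bit v → Bit (u * v)
  bit-* (inj₁ refl) _           = inj₁ refl
  bit-* (inj₂ refl) (inj₁ refl) = inj₁ refl
  bit-* (inj₂ refl) (inj₂ refl) = inj₂ refl

  bit-natural : ∀ {u} → Bit u → Natural u
  bit-natural (inj₁ e) = 0 , e
  bit-natural (inj₂ e) = 1 , e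

  disjoint-bits : ∀ {u v} → Bit u → Bit v → ¬ (u ≡ 1ℤ × v ≡ 1ℤ) → u + v ≡ (u - v) * (u - v)
  disjoint-bits (inj₁ refl) (inj₁ refl) _ = refl
  disjoint-bits (inj₁ refl) (inj₂ refl) _ = refl
  disjoint-bits (inj₂ refl) (inj₁ refl) _ = refl
  disjoint-bits (inj₂ refl) (inj₂ refl) both = ⊥-elim (both (refl , refl))

  bits-difference-one : ∀ {u v} → Bit u → Bit v → u - v ≡ 1ℤ → u ≡ 1ℤ
  bits-difference-one (inj₂ refl) _           _ = refl
  bits-difference-one (inj₁ refl) (inj₁ refl) ()
  bits-difference-one (inj₁ refl) (inj₂ refl) ()

  bits-difference-minus-one : ∀ {u v} → Bit u → Bit v → u - v ≡ -1ℤ → v ≡ 1ℤ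
  bits-difference-minus-one _           (inj₂ refl) _ = refl
  bits-difference-minus-one (inj₁ refl) (inj₁ refl) ()
  bits-difference-minus-one (inj₂ refl) (inj₁ refl) ()

  bits-sum-zero₂ : ∀ {u v} → Bit u → Bit v → u + v ≡ 0ℤ → u ≡ 0ℤ × v ≡ 0ℤ
  bits-sum-zero₂ (inj₁ refl) (inj₁ refl) _  = refl , refl
  bits-sum-zero₂ (inj₁ refl) (inj₂ refl) ()
  bits-sum-zero₂ (inj₂ refl) (inj₁ refl) ()
  bits-sum-zero₂ (inj₂ refl) (inj₂ refl) ()

  zero-or-one : ∀ {m n} (X : Mat m n) → Is01 X → X ≐ O ⊎ Σ (Fin m) λ x → Σ (Fin n) λ y → X x y ≡ 1ℤ
  zero-or-one X X-01 with FinP.any? (λ x → FinP.any? (λ y → X x y ℤP.≟ 1ℤ))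
  ... | yes one = inj₂ one
  ... | no none  = inj₁ vanishes
    where
    vanishes : X ≐ O
    vanishes x y with X-01 x y
    ... | inj₁ X≡0 = X≡0
    ... | inj₂ X≡1 = ⊥-elim (none (x , y , X≡1))

  sum-natural : ∀ {m} (f : Fin m → ℤ) → (∀ i → Natural (f i)) → Natural (sumℤ f)
  sum-natural {zero}  f h = 0 , refl
  sum-natural {suc m} f h with h zero | sum-natural (λ i → f (suc i)) (λ i → h (suc i))
  ... | t , e | t′ , e′ = t ℕ.+ t′ , cong₂ _+_ e e′

  ·-natural : ∀ {m k n} (M : Mat m k) (K : Mat k n) → Is01 M → Is01 K → ∀ x y → Natural ((M · K) x y)
  ·-natural M K M-01 K-01 x y = sum-natural _ (λ z → bit-natural (bit-* (M-01 x z) (K-01 z y)))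

  sum-tail : ∀ {m} (f : Fin (suc m) → ℤ) {u v} →
    f zero ≡ u → sumℤ f ≡ u + v → sumℤ (λ j → f (suc j)) ≡ v
  sum-tail f {u} f₀≡u e = +-cancelˡ u _ _ (trans (cong (_+ _) (sym f₀≡u)) e)

  bits-sum-zero : ∀ {m} (f : Fin m → ℤ) → (∀ i → Bit (f i)) → sumℤ f ≡ 0ℤ → ∀ i → f i ≡ 0ℤ
  bits-sum-zero {suc m} f h e i with h zero | sum-natural (λ j → f (suc j)) (λ j → bit-natural (h (suc j)))
  ... | inj₂ f₀≡1 | t , rest≡t with () ← trans (sym (cong₂ _+_ f₀≡1 rest≡t)) e
  ... | inj₁ f₀≡0 | _ with i
  ...   | zero  = f₀≡0
  ...   | suc j = bits-sum-zero (λ j → f (suc j)) (λ j → h (suc j)) (sum-tail f f₀≡0 e) j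

  bits-sum-one : ∀ {m} (f : Fin m → ℤ) → (∀ i → Bit (f i)) → sumℤ f ≡ 1ℤ →
    Σ (Fin m) λ k → ∀ j → f j ≡ I k j
  bits-sum-one {suc m} f h e with h zero
  ... | inj₂ f₀≡1 = zero , λ where
    zero    → trans f₀≡1 (sym (I-refl {suc m} zero))
    (suc j) → trans (bits-sum-zero (λ j → f (suc j)) (λ j → h (suc j)) (sum-tail f f₀≡1 e) j)
                    (sym (I-≢ {i = zero} {suc j} (λ ())))
  ... | inj₁ f₀≡0 with bits-sum-one (λ j → f (suc j)) (λ j → h (suc j)) (sum-tail f f₀≡0 e)
  ...   | k , f≡δ = suc k , λ where
    zero    → trans f₀≡0 (sym (I-≢ {i = suc k} {zero} (λ ())))
    (suc j) → trans (f≡δ j) (sym (I-injective FinP.suc-injective k j))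

  -- A family of (0,1)-matrices summing to J partitions the index pairs into
  -- classes; on each class a linear combination of the family is constant,
  -- which pins down coefficients of products as natural numbers.
  module Partition {r N} (A : Fin r → Mat N N)
    (A-01 : ∀ k → Is01 (A k)) (A-sum : (λ x y → sumℤ (λ k → A k x y)) ≐ J) where

    lincomb-on-class : ∀ {x y k} → A k x y ≡ 1ℤ → ∀ c → lincomb c A x y ≡ c k
    lincomb-on-class {x} {y} {k} Aₖxy≡1 c with bits-sum-one (λ j → A j x y) (λ j → A-01 j x y) (A-sum x y)
    ... | k′ , A≡δ = begin
      sumℤ (λ j → c j * A j x y) ≡⟨ sum-cong (λ j → cong (c j *_) (trans (A≡δ j) (I-sym k′ j))) ⟩
      sumℤ (λ j → c j * I j k′)  ≡⟨ sum-δ′ k′ c ⟩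
      c k′                       ≡⟨ cong c k′≡k ⟩
      c k ∎
      where
      k′≡k : k′ ≡ k
      k′≡k = I≡1⇒≡ (trans (sym (A≡δ k)) Aₖxy≡1)

    natural-coefficients : (∀ k → Σ (Fin N) λ x → Σ (Fin N) λ y → A k x y ≡ 1ℤ) →
      ∀ (c : ℤ) → c ≢ 0ℤ → (M : Mat N N) → InSpan A (c ⊙ M) → (∀ x y → Natural (M x y)) →
      Σ (Fin r → ℕ) λ p → M ≐ (λ x y → sumℤ (λ k → (+ p k) * A k x y))
    natural-coefficients witness c c≢0 M (span d cM≡) M-nat = p , M≡
      where
      p : Fin r → ℕ
      p k = let (x , y , _) = witness k in proj₁ (M-nat x y)
      -- c · M x y is the d-coefficient of the class of (x , y), so M is
      -- constant on each class.
      cM-on-class : ∀ {x y k} → A k x y ≡ 1ℤ → c * M x y ≡ d k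
      cM-on-class Aₖxy≡1 = trans (cM≡ _ _) (lincomb-on-class Aₖxy≡1 d)
      M-on-class : ∀ {x y k} → A k x y ≡ 1ℤ → M x y ≡ + p k
      M-on-class {k = k} Aₖxy≡1 = let (x′ , y′ , Aₖx′y′≡1) = witness k in
        trans (ℤP.*-cancelˡ-≡ c _ _ {{ℤ.≢-nonZero c≢0}}
                (trans (cM-on-class Aₖxy≡1) (sym (cM-on-class Aₖx′y′≡1))))
              (proj₂ (M-nat x′ y′))
      M≡ : M ≐ (λ x y → sumℤ (λ k → (+ p k) * A k x y))
      M≡ x y with bits-sum-one (λ j → A j x y) (λ j → A-01 j x y) (A-sum x y)
      ... | k , A≡δ = let Aₖxy≡1 = trans (A≡δ k) (I-refl k) in
        trans (M-on-class Aₖxy≡1) (sym (lincomb-on-class Aₖxy≡1 (λ j → + p j)))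

  -- Matrices of order k * n are viewed as k × k arrays of n × n blocks; the
  -- index combine i x is row x of block row i.
  module Blocks {k n : ℕ} where

    blk : Mat (k ℕ.* n) (k ℕ.* n) → Fin k → Fin k → Mat n n
    blk M i j x y = M (combine i x) (combine j y)

    blockIndex : Fin (k ℕ.* n) → Fin k
    blockIndex p = proj₁ (remQuot {k} n p)

    innerIndex : Fin (k ℕ.* n) → Fin n
    innerIndex p = proj₂ (remQuot {k} n p)

    by-blocks : {P : Fin (k ℕ.* n) → Fin (k ℕ.* n) → Set} →
      (∀ i j x y → P (combine i x) (combine j y)) → ∀ p q → P p q
    by-blocks {P} h p q = subst₂ P (FinP.combine-remQuot {k} n p) (FinP.combine-remQuot {k} n q)
      (h (blockIndex p) (blockIndex q) (innerIndex p) (innerIndex q))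

    blk-ext : ∀ M K → (∀ i j → blk M i j ≐ blk K i j) → M ≐ K
    blk-ext M K e = by-blocks {λ p q → M p q ≡ K p q} e

    blk-· : ∀ M K i j x y → blk (M · K) i j x y ≡ sumℤ (λ l → (blk M i l · blk K l j) x y)
    blk-· M K i j x y = sum-blocks k n (λ r → M (combine i x) r * K r (combine j y))

    blk-Block : ∀ B i j → blk (Block B) i j ≐ B i j
    blk-Block B i j x y = subst₂ (λ u v → B (proj₁ u) (proj₁ v) (proj₂ u) (proj₂ v) ≡ B i j x y)
      (sym (FinP.remQuot-combine i x)) (sym (FinP.remQuot-combine j y)) refl

    IKron-entry : ∀ X p q → IKron k X p q ≡ I (blockIndex p) (blockIndex q) * X (innerIndex p) (innerIndex q)
    IKron-entry X p q with blockIndex p Fin.≟ blockIndex q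
    ... | yes _ = sym (ℤP.*-identityˡ _)
    ... | no _  = refl

    blk-IKron : ∀ X i j x y → blk (IKron k X) i j x y ≡ I i j * X x y
    blk-IKron X i j x y = trans (IKron-entry X (combine i x) (combine j y))
      (subst₂ (λ u v → I (proj₁ u) (proj₁ v) * X (proj₂ u) (proj₂ v) ≡ I i j * X x y)
         (sym (FinP.remQuot-combine i x)) (sym (FinP.remQuot-combine j y)) refl)

    blk-I : ∀ i j x y → blk I i j x y ≡ I i j * I x y
    blk-I i j x y with i Fin.≟ j | x Fin.≟ y
    ... | yes refl | yes refl = I-refl (combine i x)
    ... | no i≢j   | _        = I-≢ (λ e → i≢j (FinP.combine-injectiveˡ i x j y e))
    ... | yes refl | no x≢y   =
      trans (I-≢ (λ e → x≢y (FinP.combine-injectiveʳ i x i y e))) (sym (ℤP.*-zeroʳ 1ℤ))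

    Block-cong : ∀ B B′ → (∀ i j → B i j ≐ B′ i j) → Block B ≐ Block B′
    Block-cong B B′ e = blk-ext (Block B) (Block B′) (λ i j x y →
      trans (blk-Block B i j x y) (trans (e i j x y) (sym (blk-Block B′ i j x y))))

    IKron≐Block : ∀ X → IKron k X ≐ Block {k} (λ i j → I i j ⊙ X)
    IKron≐Block X = blk-ext (IKron k X) (Block {k} (λ i j → I i j ⊙ X)) (λ i j x y →
      trans (blk-IKron X i j x y) (sym (blk-Block (λ i j → I i j ⊙ X) i j x y)))

    Block-·-Block : ∀ B B′ → Block B · Block B′ ≐ Block {k} (λ i j x y → sumℤ (λ l → (B i l · B′ l j) x y))
    Block-·-Block B B′ = blk-ext _ _ (λ i j x y → begin
      blk (Block B · Block B′) i j x y
        ≡⟨ blk-· (Block B) (Block B′) i j x y ⟩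
      sumℤ (λ l → (blk (Block B) i l · blk (Block B′) l j) x y)
        ≡⟨ sum-cong (λ l → ·-cong (blk-Block B i l) (blk-Block B′ l j) x y) ⟩
      sumℤ (λ l → (B i l · B′ l j) x y)
        ≡⟨ blk-Block (λ i j x y → sumℤ (λ l → (B i l · B′ l j) x y)) i j x y ⟨
      blk (Block {k} (λ i j x y → sumℤ (λ l → (B i l · B′ l j) x y))) i j x y ∎)

    sum-δ-· : ∀ (i : Fin k) (X : Mat n n) (B : Fin k → Mat n n) x y →
      sumℤ (λ l → ((I i l ⊙ X) · B l) x y) ≡ (X · B i) x y
    sum-δ-· i X B x y = trans (sum-cong (λ l → ⊙-· (I i l) X (B l) x y)) (sum-δ i (λ l → (X · B l) x y))

    sum-·-δ : ∀ (j : Fin k) (X : Mat n n) (B : Fin k → Mat n n) x y →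
      sumℤ (λ l → (B l · (I l j ⊙ X)) x y) ≡ (B j · X) x y
    sum-·-δ j X B x y = trans (sum-cong (λ l → trans (·-⊙ (I l j) (B l) X x y) (ℤP.*-comm (I l j) _)))
                              (sum-δ′ j (λ l → (B l · X) x y))

    IKron-·-Block : ∀ X B → IKron k X · Block B ≐ Block {k} (λ i j → X · B i j)
    IKron-·-Block X B = ≐-trans (·-congˡ (Block B) (IKron≐Block X))
      (≐-trans (Block-·-Block (λ i j → I i j ⊙ X) B)
               (Block-cong _ (λ i j → X · B i j) (λ i j → sum-δ-· i X (λ l → B l j))))

    Block-·-IKron : ∀ B X → Block B · IKron k X ≐ Block {k} (λ i j → B i j · X)
    Block-·-IKron B X = ≐-trans (·-congʳ (Block B) (IKron≐Block X))
      (≐-trans (Block-·-Block B (λ i j → I i j ⊙ X))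
               (Block-cong _ (λ i j → B i j · X) (λ i j → sum-·-δ j X (λ l → B i l))))

    IKron-·-IKron : ∀ X Y → IKron k X · IKron k Y ≐ IKron k (X · Y)
    IKron-·-IKron X Y = ≐-trans (·-congʳ (IKron k X) (IKron≐Block Y))
      (≐-trans (IKron-·-Block X (λ i j → I i j ⊙ Y))
      (≐-trans (Block-cong _ (λ i j → I i j ⊙ (X · Y)) (λ i j → ·-⊙ (I i j) X Y))
               (≐-sym (IKron≐Block (X · Y)))))

    IKron-cong : ∀ {X Y} → X ≐ Y → IKron k X ≐ IKron k Y
    IKron-cong {X} {Y} e = blk-ext (IKron k X) (IKron k Y) (λ i j x y →
      trans (blk-IKron X i j x y) (trans (cong (I i j *_) (e x y)) (sym (blk-IKron Y i j x y))))

    IKron-⊙ : ∀ c X → IKron k (c ⊙ X) ≐ c ⊙ IKron k X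
    IKron-⊙ c X = blk-ext (IKron k (c ⊙ X)) (c ⊙ IKron k X) (λ i j x y →
      trans (blk-IKron (c ⊙ X) i j x y)
            (trans (*-left-comm (I i j) c (X x y)) (cong (c *_) (sym (blk-IKron X i j x y)))))

    IKron-O : IKron k O ≐ O
    IKron-O = blk-ext (IKron k O) O (λ i j x y → trans (blk-IKron O i j x y) (ℤP.*-zeroʳ (I i j)))

    IKron-01 : ∀ {X} → Is01 X → Is01 (IKron k X)
    IKron-01 {X} X-01 = by-blocks (λ i j x y →
      subst Bit (sym (blk-IKron X i j x y)) (bit-* (I-01 i j) (X-01 x y)))

    IKron-symmetric : ∀ {X} → Symmetric X → Symmetric (IKron k X)
    IKron-symmetric {X} X-sym = blk-ext (IKron k X ᵀ) (IKron k X) (λ i j x y →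
      trans (blk-IKron X j i y x) (trans (cong₂ _*_ (I-sym j i) (X-sym x y)) (sym (blk-IKron X i j x y))))

  Sign : ℤ → Set
  Sign u = u ≡ 1ℤ ⊎ u ≡ -1ℤ

  sign-* : ∀ {u v} → Sign u → Sign v → Sign (u * v)
  sign-* (inj₁ refl) (inj₁ refl) = inj₁ refl
  sign-* (inj₁ refl) (inj₂ refl) = inj₂ refl
  sign-* (inj₂ refl) (inj₁ refl) = inj₂ refl
  sign-* (inj₂ refl) (inj₂ refl) = inj₁ refl

  sign-square : ∀ {u} → Sign u → u * u ≡ 1ℤ
  sign-square (inj₁ refl) = refl
  sign-square (inj₂ refl) = refl

  sign-*-neg : ∀ {u} → Sign u → u * - u ≡ -1ℤ
  sign-*-neg (inj₁ refl) = refl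
  sign-*-neg (inj₂ refl) = refl

  J-·-J : ∀ {m} n {k} → J {m} {n} · J {n} {k} ≐ (+ n) ⊙ J
  J-·-J n x y = sum-const n 1ℤ

  module HadamardRows {n} (H : Mat n n) (H-had : IsHadamard H) where

    rowMat : Fin n → Mat n n
    rowMat r x y = H r x * H r y

    rowMat-· : ∀ r r′ → rowMat r · rowMat r′ ≐ (+ n * I r r′) ⊙ rowMat r
    rowMat-· r r′ x y = begin
      sumℤ (λ z → (H r x * H r z) * (H r′ z * H r′ y))
        ≡⟨ sum-cong (λ z → lem (H r x) (H r z) (H r′ z) (H r′ y)) ⟩
      sumℤ (λ z → (H r x * H r′ y) * (H r z * H r′ z))
        ≡⟨ sum-*ˡ (H r x * H r′ y) (λ z → H r z * H r′ z) ⟩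
      (H r x * H r′ y) * (H · H ᵀ) r r′
        ≡⟨ cong ((H r x * H r′ y) *_) (proj₂ H-had r r′) ⟩
      (H r x * H r′ y) * (+ n * I r r′)
        ≡⟨ only-diagonal (r Fin.≟ r′) ⟩
      + n * I r r′ * (H r x * H r y) ∎
      where
      lem : ∀ a b c d → (a * b) * (c * d) ≡ (a * d) * (b * c)
      lem = solve-∀
      only-diagonal : Dec (r ≡ r′) → (H r x * H r′ y) * (+ n * I r r′) ≡ + n * I r r′ * (H r x * H r y)
      only-diagonal (yes refl) = ℤP.*-comm (H r x * H r y) (+ n * I r r)
      only-diagonal (no r≢r′) rewrite I-≢ r≢r′ = lem₂ (H r x * H r′ y) (+ n) (H r x * H r y)
        where lem₂ : ∀ a c d → a * (c * 0ℤ) ≡ c * 0ℤ * d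
              lem₂ = solve-∀

    rowMat-symmetric : ∀ r x y → rowMat r x y ≡ rowMat r y x
    rowMat-symmetric r x y = ℤP.*-comm (H r x) (H r y)

    rowMat-sign : ∀ r x y → Sign (rowMat r x y)
    rowMat-sign r x y = sign-* (proj₁ H-had r x) (proj₁ H-had r y)

    rowMat-diagonal : ∀ r x → rowMat r x x ≡ 1ℤ
    rowMat-diagonal r x = sign-square (proj₁ H-had r x)

  module FirstRows {n ℓ} (H : Mat n n) (H-had : IsHadamard H) (ℓ<n : ℓ ℕ.< n)
    (C-J : ∀ (i : Fin ℓ) → C H (suc (toℕ i)) · J {n} {n} ≐ O) where

    open HadamardRows H H-had

    Cℓ : Fin (suc ℓ) → Mat n n
    Cℓ m = C H (toℕ m)

    -- Cᵢ₊₁ is built from row number i of H.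
    row : Fin ℓ → Fin n
    row i = fromℕ< (ℕP.<-trans (FinP.toℕ<n i) ℓ<n)

    row-injective : ∀ {i j} → row i ≡ row j → i ≡ j
    row-injective {i} {j} e = FinP.toℕ-injective (begin
      toℕ i         ≡⟨ FinP.toℕ-fromℕ< _ ⟨
      toℕ (row i)   ≡⟨ cong toℕ e ⟩
      toℕ (row j)   ≡⟨ FinP.toℕ-fromℕ< _ ⟩
      toℕ j ∎)

    Cℓ-suc : ∀ i → Cℓ (suc i) ≐ rowMat (row i)
    Cℓ-suc i x y with toℕ i <? n
    ... | yes p = cong (λ r → H r x * H r y) (FinP.fromℕ<-cong _ _ refl p _)
    ... | no ¬p = ⊥-elim (¬p (ℕP.<-trans (FinP.toℕ<n i) ℓ<n))

    -- Orthogonality of the rows of H.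
    Cℓ-· : ∀ m m′ → Cℓ m · Cℓ m′ ≐ (+ n * I m m′) ⊙ Cℓ m
    Cℓ-· zero m′ x y = trans (O-· (Cℓ m′) x y) (sym (ℤP.*-zeroʳ (+ n * I zero m′)))
    Cℓ-· (suc i) zero x y = begin
      (Cℓ (suc i) · O) x y                ≡⟨ ·-O (Cℓ (suc i)) x y ⟩
      0ℤ                                  ≡⟨ lem (+ n) (Cℓ (suc i) x y) ⟨
      + n * 0ℤ * Cℓ (suc i) x y           ≡⟨ cong (λ d → + n * d * Cℓ (suc i) x y) (I-≢ {i = suc i} {zero} λ ()) ⟨
      + n * I (suc i) zero * Cℓ (suc i) x y ∎
      where lem : ∀ a c → a * 0ℤ * c ≡ 0ℤ
            lem = solve-∀
    Cℓ-· (suc i) (suc j) x y = begin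
      (Cℓ (suc i) · Cℓ (suc j)) x y                ≡⟨ ·-cong (Cℓ-suc i) (Cℓ-suc j) x y ⟩
      (rowMat (row i) · rowMat (row j)) x y        ≡⟨ rowMat-· (row i) (row j) x y ⟩
      + n * I (row i) (row j) * rowMat (row i) x y
        ≡⟨ cong₂ (λ d v → + n * d * v) same-δ (sym (Cℓ-suc i x y)) ⟩
      + n * I (suc i) (suc j) * Cℓ (suc i) x y ∎
      where
      same-δ : I (row i) (row j) ≡ I (suc i) (suc j)
      same-δ = trans (I-injective row-injective i j) (sym (I-injective FinP.suc-injective i j))

    Cℓ-symmetric : ∀ m x y → Cℓ m x y ≡ Cℓ m y x
    Cℓ-symmetric zero    x y = refl
    Cℓ-symmetric (suc i) x y = trans (Cℓ-suc i x y) (trans (rowMat-symmetric (row i) x y) (sym (Cℓ-suc i y x)))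

    Cℓ-sign : ∀ m → m ≢ zero → ∀ x y → Sign (Cℓ m x y)
    Cℓ-sign zero    m≢0 = ⊥-elim (m≢0 refl)
    Cℓ-sign (suc i) _ x y = subst Sign (sym (Cℓ-suc i x y)) (rowMat-sign (row i) x y)

    Cℓ-diagonal : ∀ m → m ≢ zero → ∀ x → Cℓ m x x ≡ 1ℤ
    Cℓ-diagonal zero    m≢0 = ⊥-elim (m≢0 refl)
    Cℓ-diagonal (suc i) _ x = trans (Cℓ-suc i x x) (rowMat-diagonal (row i) x)

    -- Row sums (hypothesis) and, by symmetry, column sums of every Cₘ vanish.
    Cℓ-·-J : ∀ m → Cℓ m · J {n} {n} ≐ O
    Cℓ-·-J zero    = O-· {n} {n} J
    Cℓ-·-J (suc i) = C-J i

    J-·-Cℓ : ∀ m → J {n} {n} · Cℓ m ≐ O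
    J-·-Cℓ m x y =
      trans (sum-cong (λ z → trans (ℤP.*-comm 1ℤ (Cℓ m z y)) (cong (_* 1ℤ) (Cℓ-symmetric m z y))))
            (Cℓ-·-J m y x)

    S : Mat n n
    S x y = sumℤ (λ m → Cℓ m x y)

    S-·-Cℓ : ∀ m′ → S · Cℓ m′ ≐ (+ n) ⊙ Cℓ m′
    S-·-Cℓ m′ x y = begin
      (S · Cℓ m′) x y                             ≡⟨ sum-· Cℓ (Cℓ m′) x y ⟩
      sumℤ (λ m → (Cℓ m · Cℓ m′) x y)
        ≡⟨ sum-cong (λ m → trans (Cℓ-· m m′ x y) (lem (+ n) (I m m′) (Cℓ m x y))) ⟩
      sumℤ (λ m → (+ n * Cℓ m x y) * I m m′)      ≡⟨ sum-δ′ m′ (λ m → + n * Cℓ m x y) ⟩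
      + n * Cℓ m′ x y ∎
      where lem : ∀ a b c → a * b * c ≡ (a * c) * b
            lem = solve-∀

    Cℓ-·-S : ∀ m → Cℓ m · S ≐ (+ n) ⊙ Cℓ m
    Cℓ-·-S m x y = begin
      (Cℓ m · S) x y                              ≡⟨ ·-sum (Cℓ m) Cℓ x y ⟩
      sumℤ (λ m′ → (Cℓ m · Cℓ m′) x y)
        ≡⟨ sum-cong (λ m′ → trans (Cℓ-· m m′ x y) (lem (+ n) (I m m′) (Cℓ m x y))) ⟩
      sumℤ (λ m′ → I m m′ * (+ n * Cℓ m x y))     ≡⟨ sum-δ m (λ _ → + n * Cℓ m x y) ⟩
      + n * Cℓ m x y ∎
      where lem : ∀ a b c → a * b * c ≡ b * (a * c)
            lem = solve-∀

    S-·-S : S · S ≐ (+ n) ⊙ S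
    S-·-S x y = trans (·-sum S Cℓ x y) (trans (sum-cong (λ m → S-·-Cℓ m x y)) (sum-*ˡ (+ n) (λ m → Cℓ m x y)))

    S-·-J : S · J {n} {n} ≐ O
    S-·-J x y = trans (sum-· Cℓ J x y) (sum-zero (λ m → (Cℓ m · J) x y) (λ m → Cℓ-·-J m x y))

    J-·-S : J {n} {n} · S ≐ O
    J-·-S x y = trans (·-sum J Cℓ x y) (sum-zero (λ m → (J · Cℓ m) x y) (λ m → J-·-Cℓ m x y))

  ε-sign : ∀ {m} (i j : Fin m) → Sign (ε i j)
  ε-sign i j with toℕ i ℕ.≤? toℕ j
  ... | yes _ = inj₁ refl
  ... | no _  = inj₂ refl

  ε-antisymmetric : ∀ {m} {i j : Fin m} → i ≢ j → ε j i ≡ - ε i j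
  ε-antisymmetric {i = i} {j} i≢j with toℕ i ℕ.≤? toℕ j | toℕ j ℕ.≤? toℕ i
  ... | yes i≤j | yes j≤i = ⊥-elim (i≢j (FinP.toℕ-injective (ℕP.≤-antisym i≤j j≤i)))
  ... | yes _   | no _    = refl
  ... | no _    | yes _   = refl
  ... | no i≰j  | no j≰i  = ⊥-elim (i≰j (ℕP.≰⇒≥ j≰i))

  module LatinBlock {n ℓ} (H : Mat n n) (H-had : IsHadamard H) (ℓ<n : ℓ ℕ.< n)
    (C-J : ∀ (i : Fin ℓ) → C H (suc (toℕ i)) · J {n} {n} ≐ O)
    (L : Fin (suc ℓ) → Fin (suc ℓ) → Fin (suc ℓ)) (L-latin : IsLatinSquare L)
    (L-sym : ∀ i j → L i j ≡ L j i) (L-diag : ∀ i → L i i ≡ zero) where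

    open FirstRows H H-had ℓ<n C-J public
    open Blocks {suc ℓ} {n} public

    N : ℕ
    N = suc ℓ ℕ.* n

    L̄ : Mat N N
    L̄ = Lbar H L

    IS IJ : Mat N N
    IS = IKron (suc ℓ) S
    IJ = IKron (suc ℓ) J

    blk-L̄ : ∀ i j → blk L̄ i j ≐ ε i j ⊙ Cℓ (L i j)
    blk-L̄ i j = blk-Block (λ i j → ε i j ⊙ Cℓ (L i j)) i j

    -- Off the diagonal L never takes the value 0, as 0 already sits on the
    -- diagonal of each row.
    L-offdiagonal : ∀ {i j} → i ≢ j → L i j ≢ zero
    L-offdiagonal {i} {j} i≢j e = i≢j (sym (proj₁ L-latin i (trans e (sym (L-diag i)))))

    -- L̄ is antisymmetric: ε is antisymmetric off the diagonal, each Cₘ is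
    -- symmetric, and the diagonal blocks are C₀ = O.
    L̄-antisymmetric : ∀ p q → L̄ q p ≡ - L̄ p q
    L̄-antisymmetric = by-blocks {λ p q → L̄ q p ≡ - L̄ p q} λ i j x y →
      trans (blk-L̄ j i y x) (trans (swap (i Fin.≟ j)) (cong -_ (sym (blk-L̄ i j x y))))
      where
      swap : ∀ {i j x y} → Dec (i ≡ j) → ε j i * Cℓ (L j i) y x ≡ - (ε i j * Cℓ (L i j) x y)
      swap {i} (yes refl) rewrite L-diag i = trans (ℤP.*-zeroʳ (ε i i)) (sym (cong -_ (ℤP.*-zeroʳ (ε i i))))
      swap {i} {j} {x} {y} (no i≢j) = begin
        ε j i * Cℓ (L j i) y x
          ≡⟨ cong₂ _*_ (ε-antisymmetric i≢j) (trans (cong (λ m → Cℓ m y x) (L-sym j i)) (Cℓ-symmetric (L i j) y x)) ⟩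
        - ε i j * Cℓ (L i j) x y      ≡⟨ ℤP.neg-distribˡ-* (ε i j) (Cℓ (L i j) x y) ⟨
        - (ε i j * Cℓ (L i j) x y)    ∎

    -- Entries of L̄ are ±1 off the diagonal blocks and 0 on them.
    L̄-square : ∀ p q → L̄ p q * L̄ p q ≡ 1ℤ - IJ p q
    L̄-square = by-blocks {λ p q → L̄ p q * L̄ p q ≡ 1ℤ - IJ p q} λ i j x y →
      trans (cong (λ v → v * v) (blk-L̄ i j x y))
            (trans (square (i Fin.≟ j)) (cong (_-_ 1ℤ) (sym (trans (blk-IKron J i j x y) (ℤP.*-identityʳ (I i j))))))
      where
      square : ∀ {i j x y} → Dec (i ≡ j) → (ε i j * Cℓ (L i j) x y) * (ε i j * Cℓ (L i j) x y) ≡ 1ℤ - I i j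
      square {i} (yes refl) rewrite L-diag i | I-refl i = cong (λ v → v * v) (ℤP.*-zeroʳ (ε i i))
      square {i} {j} {x} {y} (no i≢j) rewrite I-≢ i≢j =
        sign-square (sign-* (ε-sign i j) (Cℓ-sign (L i j) (L-offdiagonal i≢j) x y))

    IKron-·-L̄ : ∀ X → IKron (suc ℓ) X · L̄ ≐ Block {suc ℓ} (λ i j → ε i j ⊙ (X · Cℓ (L i j)))
    IKron-·-L̄ X = ≐-trans (IKron-·-Block X (λ i j → ε i j ⊙ Cℓ (L i j)))
      (Block-cong _ _ (λ i j → ·-⊙ (ε i j) X (Cℓ (L i j))))

    L̄-·-IKron : ∀ X → L̄ · IKron (suc ℓ) X ≐ Block {suc ℓ} (λ i j → ε i j ⊙ (Cℓ (L i j) · X))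
    L̄-·-IKron X = ≐-trans (Block-·-IKron (λ i j → ε i j ⊙ Cℓ (L i j)) X)
      (Block-cong _ _ (λ i j → ⊙-· (ε i j) (Cℓ (L i j)) X))

    IS-·-L̄ : IS · L̄ ≐ (+ n) ⊙ L̄
    IS-·-L̄ = ≐-trans (IKron-·-L̄ S) (Block-cong _ (λ i j → (+ n) ⊙ (ε i j ⊙ Cℓ (L i j)))
      (λ i j x y → trans (cong (ε i j *_) (S-·-Cℓ (L i j) x y)) (*-left-comm (ε i j) (+ n) (Cℓ (L i j) x y))))

    L̄-·-IS : L̄ · IS ≐ (+ n) ⊙ L̄
    L̄-·-IS = ≐-trans (L̄-·-IKron S) (Block-cong _ (λ i j → (+ n) ⊙ (ε i j ⊙ Cℓ (L i j)))
      (λ i j x y → trans (cong (ε i j *_) (Cℓ-·-S (L i j) x y)) (*-left-comm (ε i j) (+ n) (Cℓ (L i j) x y))))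

    IJ-·-L̄ : IJ · L̄ ≐ O
    IJ-·-L̄ = ≐-trans (IKron-·-L̄ J) (Block-cong _ (λ _ _ → O)
      (λ i j x y → trans (cong (ε i j *_) (J-·-Cℓ (L i j) x y)) (ℤP.*-zeroʳ (ε i j))))

    L̄-·-IJ : L̄ · IJ ≐ O
    L̄-·-IJ = ≐-trans (L̄-·-IKron J) (Block-cong _ (λ _ _ → O)
      (λ i j x y → trans (cong (ε i j *_) (Cℓ-·-J (L i j) x y)) (ℤP.*-zeroʳ (ε i j))))

    -- J is the block matrix all of whose blocks are J.
    J-·-L̄ : J · L̄ ≐ O
    J-·-L̄ = ≐-trans (Block-·-Block (λ _ _ → J) (λ i j → ε i j ⊙ Cℓ (L i j))) (Block-cong _ (λ _ _ → O)
      (λ i j x y → sum-zero _ (λ l → trans (·-⊙ (ε l j) J (Cℓ (L l j)) x y)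
                                          (trans (cong (ε l j *_) (J-·-Cℓ (L l j) x y)) (ℤP.*-zeroʳ (ε l j))))))

    L̄-·-J : L̄ · J ≐ O
    L̄-·-J = ≐-trans (Block-·-Block (λ i j → ε i j ⊙ Cℓ (L i j)) (λ _ _ → J)) (Block-cong _ (λ _ _ → O)
      (λ i j x y → sum-zero _ (λ l → trans (⊙-· (ε i l) (Cℓ (L i l)) J x y)
                                          (trans (cong (ε i l *_) (Cℓ-·-J (L i l) x y)) (ℤP.*-zeroʳ (ε i l))))))

    -- The (l)-th term of block (i , j) of L̄²: it survives only for i = j
    -- (L is a Latin square) and then equals −n C_{Lᵢₗ} (ε is antisymmetric).
    L̄-·-L̄-term : ∀ i j l x y →
      (ε i l * ε l j) * ((+ n * I (L i l) (L l j)) * Cℓ (L i l) x y) ≡ I i j * (- + n * Cℓ (L i l) x y)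
    L̄-·-L̄-term i j l x y with i Fin.≟ j
    ... | no i≢j rewrite I-≢ (λ e → i≢j (proj₂ L-latin l (trans e (L-sym l j)))) =
      lem (ε i l * ε l j) (+ n) (Cℓ (L i l) x y)
      where lem : ∀ a b c → a * ((b * 0ℤ) * c) ≡ 0ℤ * (- b * c)
            lem = solve-∀
    ... | yes refl with i Fin.≟ l
    ...   | yes refl rewrite L-diag i = lem (ε i i * ε i i) (+ n) 1ℤ
      where lem : ∀ a b c → a * ((b * c) * 0ℤ) ≡ 1ℤ * (- b * 0ℤ)
            lem = solve-∀
    ...   | no i≢l rewrite ε-antisymmetric i≢l | sym (L-sym i l) | I-refl (L i l) | sign-*-neg (ε-sign i l) =
      lem (+ n) (Cℓ (L i l) x y)
      where lem : ∀ b c → -1ℤ * ((b * 1ℤ) * c) ≡ 1ℤ * (- b * c)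
            lem = solve-∀

    -- L̄² = −n (I ⊗ S): each row of L runs through all the Cₘ.
    L̄-·-L̄ : L̄ · L̄ ≐ (- + n) ⊙ IS
    L̄-·-L̄ = ≐-trans (Block-·-Block (λ i j → ε i j ⊙ Cℓ (L i j)) (λ i j → ε i j ⊙ Cℓ (L i j)))
      (≐-trans (Block-cong _ (λ i j → (- + n) ⊙ (I i j ⊙ S)) block)
               (λ p q → cong ((- + n) *_) (sym (IKron≐Block S p q))))
      where
      block : ∀ i j x y → sumℤ (λ l → ((ε i l ⊙ Cℓ (L i l)) · (ε l j ⊙ Cℓ (L l j))) x y) ≡ - + n * (I i j * S x y)
      block i j x y = begin
        sumℤ (λ l → ((ε i l ⊙ Cℓ (L i l)) · (ε l j ⊙ Cℓ (L l j))) x y)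
          ≡⟨ sum-cong (λ l → trans (⊙-·-⊙ (ε i l) (ε l j) (Cℓ (L i l)) (Cℓ (L l j)) x y)
                                   (cong ((ε i l * ε l j) *_) (Cℓ-· (L i l) (L l j) x y))) ⟩
        sumℤ (λ l → (ε i l * ε l j) * ((+ n * I (L i l) (L l j)) * Cℓ (L i l) x y))
          ≡⟨ sum-cong (λ l → L̄-·-L̄-term i j l x y) ⟩
        sumℤ (λ l → I i j * (- + n * Cℓ (L i l) x y))
          ≡⟨ trans (sum-*ˡ (I i j) (λ l → - + n * Cℓ (L i l) x y))
                   (cong (I i j *_) (sum-*ˡ (- + n) (λ l → Cℓ (L i l) x y))) ⟩
        I i j * (- + n * sumℤ (λ l → Cℓ (L i l) x y))
          ≡⟨ cong (λ s → I i j * (- + n * s)) (sum-reindex (L i) (proj₁ L-latin i) (λ m → Cℓ m x y)) ⟩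
        I i j * (- + n * S x y)
          ≡⟨ *-left-comm (I i j) (- + n) (S x y) ⟩
        - + n * (I i j * S x y) ∎

    -- The generators I, I ⊗ S, I ⊗ J, J, L̄ span a commutative algebra: the
    -- product of two generators is a multiple of a generator.
    G : Fin 5 → Mat N N
    G 0F = I
    G 1F = IS
    G 2F = IJ
    G 3F = J
    G 4F = L̄

    -- G a · G b = coefficient ⊙ G index, for (coefficient , index) = table a b.
    table : Fin 5 → Fin 5 → ℤ × Fin 5
    table 0F b  = 1ℤ , b
    table a  0F = 1ℤ , a
    table 1F 1F = + n , 1F
    table 1F 2F = 0ℤ , 0F
    table 1F 3F = 0ℤ , 0F
    table 1F 4F = + n , 4F
    table 2F 1F = 0ℤ , 0F
    table 2F 2F = + n , 2F
    table 2F 3F = + n , 3F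
    table 2F 4F = 0ℤ , 0F
    table 3F 1F = 0ℤ , 0F
    table 3F 2F = + n , 3F
    table 3F 3F = + N , 3F
    table 3F 4F = 0ℤ , 0F
    table 4F 1F = + n , 4F
    table 4F 2F = 0ℤ , 0F
    table 4F 3F = 0ℤ , 0F
    table 4F 4F = - + n , 1F

    -- The table is symmetric, which makes the generators commute.
    table-symmetric : ∀ a b → table a b ≡ table b a
    table-symmetric 0F 0F = refl
    table-symmetric 0F (suc b) = refl
    table-symmetric (suc a) 0F = refl
    table-symmetric 1F 1F = refl
    table-symmetric 1F 2F = refl
    table-symmetric 1F 3F = refl
    table-symmetric 1F 4F = refl
    table-symmetric 2F 1F = refl
    table-symmetric 2F 2F = refl
    table-symmetric 2F 3F = refl
    table-symmetric 2F 4F = refl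
    table-symmetric 3F 1F = refl
    table-symmetric 3F 2F = refl
    table-symmetric 3F 3F = refl
    table-symmetric 3F 4F = refl
    table-symmetric 4F 1F = refl
    table-symmetric 4F 2F = refl
    table-symmetric 4F 3F = refl
    table-symmetric 4F 4F = refl

    entry : ℤ × Fin 5 → Mat N N
    entry (c , g) = c ⊙ G g

    private
      vanishes : ∀ {M : Mat N N} → M ≐ O → M ≐ entry (0ℤ , 0F)
      vanishes M≐O x y = trans (M≐O x y) (sym (ℤP.*-zeroˡ (I x y)))

      IKron-product : ∀ {X Y Z} → X · Y ≐ Z → IKron (suc ℓ) X · IKron (suc ℓ) Y ≐ IKron (suc ℓ) Z
      IKron-product {X} {Y} e = ≐-trans (IKron-·-IKron X Y) (IKron-cong e)

    G-· : ∀ a b → G a · G b ≐ entry (table a b)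
    G-· 0F b       x y = trans (I-· (G b) x y) (sym (ℤP.*-identityˡ _))
    G-· (suc a) 0F x y = trans (·-I (G (suc a)) x y) (sym (ℤP.*-identityˡ _))
    G-· 1F 1F = ≐-trans (IKron-product S-·-S) (IKron-⊙ (+ n) S)
    G-· 1F 2F = vanishes (≐-trans (IKron-product S-·-J) IKron-O)
    G-· 1F 3F = vanishes (≐-trans (IKron-·-Block S (λ _ _ → J)) (Block-cong _ (λ _ _ → O) (λ _ _ → S-·-J)))
    G-· 1F 4F = IS-·-L̄
    G-· 2F 1F = vanishes (≐-trans (IKron-product J-·-S) IKron-O)
    G-· 2F 2F = ≐-trans (IKron-product (J-·-J n)) (IKron-⊙ (+ n) J)
    G-· 2F 3F = ≐-trans (IKron-·-Block J (λ _ _ → J)) (Block-cong _ (λ _ _ → (+ n) ⊙ J) (λ _ _ → J-·-J n))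
    G-· 2F 4F = vanishes IJ-·-L̄
    G-· 3F 1F = vanishes (≐-trans (Block-·-IKron (λ _ _ → J) S) (Block-cong _ (λ _ _ → O) (λ _ _ → J-·-S)))
    G-· 3F 2F = ≐-trans (Block-·-IKron (λ _ _ → J) J) (Block-cong _ (λ _ _ → (+ n) ⊙ J) (λ _ _ → J-·-J n))
    G-· 3F 3F = J-·-J N
    G-· 3F 4F = vanishes J-·-L̄
    G-· 4F 1F = L̄-·-IS
    G-· 4F 2F = vanishes L̄-·-IJ
    G-· 4F 3F = vanishes L̄-·-J
    G-· 4F 4F = L̄-·-L̄

    G-closed : ∀ a b → InSpan G (G a · G b)
    G-closed a b = span-≐ (≐-sym (G-· a b)) (span-⊙ (proj₁ (table a b)) (span-member (proj₂ (table a b))))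

    G-commute : ∀ a b → G a · G b ≐ G b · G a
    G-commute a b = ≐-trans (G-· a b)
      (≐-trans (λ x y → cong (λ t → entry t x y) (table-symmetric a b)) (≐-sym (G-· b a)))

  not-multiple : ∀ {ℓ m} (c : ℤ) → 0 ℕ.< ℓ → ℓ ℕ.< m → + ℓ + c * + m ≢ 0ℤ
  not-multiple {suc ℓ} {m} c _ ℓ<m e = >⇒∤ ℓ<m (divides ∣ c ∣ (begin
    ∣ + suc ℓ ∣      ≡⟨ cong ∣_∣ (ℤP.i-j≡0⇒i≡j (+ suc ℓ) (- (c * + m))
                           (trans (cong (_+_ (+ suc ℓ)) (ℤP.neg-involutive (c * + m))) e)) ⟩
    ∣ - (c * + m) ∣  ≡⟨ ℤP.∣-i∣≡∣i∣ (c * + m) ⟩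
    ∣ c * + m ∣      ≡⟨ ℤP.abs-* c (+ m) ⟩
    ∣ c ∣ ℕ.* m      ∎))

  affine-row-sum : ∀ {n ℓ} (x : Fin n) (c : ℤ) → 0 ℕ.< ℓ → ℓ ℕ.< n ∸ 1 →
    sumℤ (λ y → (+ ℓ * I x y + c * (1ℤ - I x y)) * 1ℤ) ≢ 0ℤ
  affine-row-sum {suc n′} {ℓ} x c 0<ℓ ℓ<n′ row≡0 = not-multiple c 0<ℓ ℓ<n′ (trans (sym row-sum) row≡0)
    where
    row-sum : sumℤ (λ y → (+ ℓ * I x y + c * (1ℤ - I x y)) * 1ℤ) ≡ + ℓ + c * + n′
    row-sum = begin
      sumℤ (λ y → (+ ℓ * I x y + c * (1ℤ - I x y)) * 1ℤ)
        ≡⟨ sum-cong (λ y → lem (+ ℓ) c (I x y)) ⟩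
      sumℤ (λ y → (+ ℓ - c) * (I x y * 1ℤ) + c)
        ≡⟨ sum-+ (λ y → (+ ℓ - c) * (I x y * 1ℤ)) (λ _ → c) ⟩
      sumℤ (λ y → (+ ℓ - c) * (I x y * 1ℤ)) + sumℤ {suc n′} (λ _ → c)
        ≡⟨ cong₂ _+_ (trans (sum-*ˡ (+ ℓ - c) (λ y → I x y * 1ℤ)) (cong ((+ ℓ - c) *_) (sum-δ x (λ _ → 1ℤ))))
                     (sum-const (suc n′) c) ⟩
      (+ ℓ - c) * 1ℤ + (1ℤ + + n′) * c
        ≡⟨ lem₂ (+ ℓ) c (+ n′) ⟩
      + ℓ + c * + n′ ∎
      where lem : ∀ l c i → (l * i + c * (1ℤ - i)) * 1ℤ ≡ (l - c) * (i * 1ℤ) + c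
            lem = solve-∀
            lem₂ : ∀ l c m → (l - c) * 1ℤ + (1ℤ + m) * c ≡ l + c * m
            lem₂ = solve-∀

  module Scheme {n ℓ} (H : Mat n n) (H-had : IsHadamard H) (1<ℓ : 1 ℕ.< ℓ) (ℓ<n-1 : ℓ ℕ.< n ∸ 1)
    (a b : ℤ) (A : Mat n n) (a≢b : a ≢ b) (A-01 : Is01 A) (A-sym : Symmetric A) (A-diag : ∀ x → A x x ≡ 0ℤ)
    (S-hyp : (λ x y → sumℤ (λ (i : Fin ℓ) → C H (suc (toℕ i)) x y))
               ≐ ((+ ℓ) ⊙ I) ⊕ ((a ⊙ A) ⊕ (b ⊙ ((J ⊖ A) ⊖ I))))
    (C-J : ∀ (i : Fin ℓ) → C H (suc (toℕ i)) · J {n} {n} ≐ O)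
    (L : Fin (suc ℓ) → Fin (suc ℓ) → Fin (suc ℓ)) (L-latin : IsLatinSquare L)
    (L-sym : ∀ i j → L i j ≡ L j i) (L-diag : ∀ i → L i i ≡ zero)
    (A₃ A₄ : Mat (suc ℓ ℕ.* n) (suc ℓ ℕ.* n)) (A₃-01 : Is01 A₃) (A₄-01 : Is01 A₄)
    (A₃A₄-disjoint : ∀ x y → ¬ (A₃ x y ≡ 1ℤ × A₄ x y ≡ 1ℤ))
    (L̄≐A₃⊖A₄ : Lbar H L ≐ A₃ ⊖ A₄) where

    ℓ<n : ℓ ℕ.< n
    ℓ<n = ℕP.<-≤-trans ℓ<n-1 (ℕP.m∸n≤m n 1)

    open LatinBlock H H-had ℓ<n C-J L L-latin L-sym L-diag

    Aᶜ : Mat n n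
    Aᶜ = (J ⊖ A) ⊖ I

    A₁ A₂ : Mat N N
    A₁ = IKron (suc ℓ) A
    A₂ = IKron (suc ℓ) Aᶜ

    𝒜 : Fin 5 → Mat N N
    𝒜 = fam5 I A₁ A₂ A₃ A₄

    S-entries : ∀ x y → S x y ≡ + ℓ * I x y + (a * A x y + b * ((1ℤ - A x y) - I x y))
    S-entries x y = trans (ℤP.+-identityˡ _) (S-hyp x y)

    Aᶜ-01 : Is01 Aᶜ
    Aᶜ-01 x y with x Fin.≟ y | A-01 x y
    ... | yes refl | _      rewrite A-diag x = inj₁ refl
    ... | no _     | inj₁ e rewrite e = inj₂ refl
    ... | no _     | inj₂ e rewrite e = inj₁ refl

    Aᶜ-symmetric : Symmetric Aᶜ
    Aᶜ-symmetric x y = cong₂ (λ u v → (1ℤ - u) - v) (A-sym x y) (I-sym y x)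

    Aᶜ-diag : ∀ x → Aᶜ x x ≡ 0ℤ
    Aᶜ-diag x = cong₂ (λ u v → (1ℤ - u) - v) (A-diag x) (I-refl x)

    𝒜-01 : ∀ k → Is01 (𝒜 k)
    𝒜-01 0F = I-01
    𝒜-01 1F = IKron-01 A-01
    𝒜-01 2F = IKron-01 Aᶜ-01
    𝒜-01 3F = A₃-01
    𝒜-01 4F = A₄-01

    A₃⊕A₄ : A₃ ⊕ A₄ ≐ J ⊖ IJ
    A₃⊕A₄ p q = begin
      A₃ p q + A₄ p q                   ≡⟨ disjoint-bits (A₃-01 p q) (A₄-01 p q) (A₃A₄-disjoint p q) ⟩
      (A₃ p q - A₄ p q) * (A₃ p q - A₄ p q) ≡⟨ cong (λ v → v * v) (L̄≐A₃⊖A₄ p q) ⟨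
      L̄ p q * L̄ p q                     ≡⟨ L̄-square p q ⟩
      1ℤ - IJ p q          ∎

    diagonal-blocks : ∀ p q → I p q + (A₁ p q + A₂ p q) ≡ IJ p q
    diagonal-blocks = by-blocks {λ p q → I p q + (A₁ p q + A₂ p q) ≡ IJ p q}
      λ i j x y → begin
        blk I i j x y + (blk A₁ i j x y + blk A₂ i j x y)
          ≡⟨ cong₂ _+_ (blk-I i j x y) (cong₂ _+_ (blk-IKron A i j x y) (blk-IKron Aᶜ i j x y)) ⟩
        I i j * I x y + (I i j * A x y + I i j * ((1ℤ - A x y) - I x y))
          ≡⟨ lem (I i j) (I x y) (A x y) ⟩
        I i j * 1ℤ
          ≡⟨ blk-IKron J i j x y ⟨
        blk IJ i j x y ∎
      where lem : ∀ u w v → u * w + (u * v + u * ((1ℤ - v) - w)) ≡ u * 1ℤ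
            lem = solve-∀

    𝒜-sum : (λ x y → sumℤ (λ k → 𝒜 k x y)) ≐ J
    𝒜-sum p q = begin
      I p q + (A₁ p q + (A₂ p q + (A₃ p q + (A₄ p q + 0ℤ))))
        ≡⟨ lem (I p q) (A₁ p q) (A₂ p q) (A₃ p q) (A₄ p q) ⟩
      (I p q + (A₁ p q + A₂ p q)) + (A₃ p q + A₄ p q)
        ≡⟨ cong₂ _+_ (diagonal-blocks p q) (A₃⊕A₄ p q) ⟩
      IJ p q + (1ℤ - IJ p q)
        ≡⟨ lem₂ (IJ p q) ⟩
      1ℤ ∎
      where lem : ∀ i u v s t → i + (u + (v + (s + (t + 0ℤ)))) ≡ (i + (u + v)) + (s + t)
            lem = solve-∀
            lem₂ : ∀ u → u + (1ℤ - u) ≡ 1ℤ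
            lem₂ = solve-∀

    IS-in-𝒜 : ((+ ℓ) ⊙ I) ⊕ ((a ⊙ A₁) ⊕ (b ⊙ A₂)) ≐ IS
    IS-in-𝒜 = blk-ext _ _ (λ i j x y → begin
      + ℓ * blk I i j x y + (a * blk A₁ i j x y + b * blk A₂ i j x y)
        ≡⟨ cong₂ _+_ (cong (+ ℓ *_) (blk-I i j x y))
                     (cong₂ _+_ (cong (a *_) (blk-IKron A i j x y)) (cong (b *_) (blk-IKron Aᶜ i j x y))) ⟩
      + ℓ * (I i j * I x y) + (a * (I i j * A x y) + b * (I i j * Aᶜ x y))
        ≡⟨ lem (I i j) (+ ℓ) (I x y) a (A x y) b (Aᶜ x y) ⟩
      I i j * (+ ℓ * I x y + (a * A x y + b * Aᶜ x y))
        ≡⟨ cong (I i j *_) (S-entries x y) ⟨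
      I i j * S x y
        ≡⟨ blk-IKron S i j x y ⟨
      blk IS i j x y ∎)
      where lem : ∀ u l w a v b c → l * (u * w) + (a * (u * v) + b * (u * c)) ≡ u * (l * w + (a * v + b * c))
            lem = solve-∀

    L̄-in-𝒜 : A₃ ⊕ (-1ℤ ⊙ A₄) ≐ L̄
    L̄-in-𝒜 p q = trans (cong (_+_ (A₃ p q)) (ℤP.-1*i≡-i (A₄ p q))) (sym (L̄≐A₃⊖A₄ p q))

    G-in-𝒜 : ∀ g → InSpan 𝒜 (G g)
    G-in-𝒜 0F = span-member 0F
    G-in-𝒜 1F = span-≐ IS-in-𝒜 (span-⊕ (span-⊙ (+ ℓ) (span-member 0F))
                                  (span-⊕ (span-⊙ a (span-member 1F)) (span-⊙ b (span-member 2F))))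
    G-in-𝒜 2F = span-≐ diagonal-blocks (span-⊕ (span-member 0F) (span-⊕ (span-member 1F) (span-member 2F)))
    G-in-𝒜 3F = span-≐ 𝒜-sum (span-sum 𝒜 span-member)
    G-in-𝒜 4F = span-≐ L̄-in-𝒜 (span-⊕ (span-member 3F) (span-⊙ -1ℤ (span-member 4F)))

    -- Conversely, e = 2(a − b) times each class is a combination of generators.
    e : ℤ
    e = + 2 * (a - b)

    -- S = (ℓ − b) I + (a − b) A + b J, so S determines A.
    A-from-S : ∀ x y → + 2 * (S x y + ((b - + ℓ) * I x y + - b * 1ℤ)) ≡ e * A x y
    A-from-S x y = trans (cong (λ s → + 2 * (s + ((b - + ℓ) * I x y + - b * 1ℤ))) (S-entries x y))
                         (lem (+ ℓ) a b (I x y) (A x y))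
      where lem : ∀ l a b i v → + 2 * ((l * i + (a * v + b * ((1ℤ - v) - i))) + ((b - l) * i + - b * 1ℤ))
                               ≡ + 2 * (a - b) * v
            lem = solve-∀

    A₁-in-G : (+ 2) ⊙ (IS ⊕ (((b - + ℓ) ⊙ I) ⊕ ((- b) ⊙ IJ))) ≐ e ⊙ A₁
    A₁-in-G = blk-ext _ _ (λ i j x y → begin
      + 2 * (blk IS i j x y + ((b - + ℓ) * blk I i j x y + - b * blk IJ i j x y))
        ≡⟨ cong (+ 2 *_) (cong₂ _+_ (blk-IKron S i j x y)
                                    (cong₂ _+_ (cong ((b - + ℓ) *_) (blk-I i j x y)) (cong (- b *_) (blk-IKron J i j x y)))) ⟩
      + 2 * (I i j * S x y + ((b - + ℓ) * (I i j * I x y) + - b * (I i j * 1ℤ)))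
        ≡⟨ lem (I i j) (S x y) (I x y) (b - + ℓ) b ⟩
      I i j * (+ 2 * (S x y + ((b - + ℓ) * I x y + - b * 1ℤ)))
        ≡⟨ cong (I i j *_) (A-from-S x y) ⟩
      I i j * (e * A x y)
        ≡⟨ *-left-comm (I i j) e (A x y) ⟩
      e * (I i j * A x y)
        ≡⟨ cong (e *_) (blk-IKron A i j x y) ⟨
      e * blk A₁ i j x y ∎)
      where lem : ∀ u s w c b → + 2 * (u * s + (c * (u * w) + - b * (u * 1ℤ)))
                               ≡ u * (+ 2 * (s + (c * w + - b * 1ℤ)))
            lem = solve-∀

    A₂-in-G : (e ⊙ IJ) ⊕ ((-1ℤ ⊙ (e ⊙ A₁)) ⊕ ((- e) ⊙ I)) ≐ e ⊙ A₂
    A₂-in-G p q = begin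
      e * IJ p q + (-1ℤ * (e * A₁ p q) + - e * I p q)
        ≡⟨ lem e (IJ p q) (A₁ p q) (I p q) ⟩
      e * (IJ p q - (I p q + A₁ p q))
        ≡⟨ cong (λ t → e * (t - (I p q + A₁ p q))) (diagonal-blocks p q) ⟨
      e * ((I p q + (A₁ p q + A₂ p q)) - (I p q + A₁ p q))
        ≡⟨ lem₂ e (I p q) (A₁ p q) (A₂ p q) ⟩
      e * A₂ p q ∎
      where
      lem : ∀ e j v i → e * j + (-1ℤ * (e * v) + - e * i) ≡ e * (j - (i + v))
      lem = solve-∀
      lem₂ : ∀ e i v w → e * ((i + (v + w)) - (i + v)) ≡ e * w
      lem₂ = solve-∀

    -- The off-diagonal blocks J − I ⊗ J are split by L̄ into A₃ (entries +1)
    -- and A₄ (entries −1).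
    twice-A₃ : ∀ p q → + 2 * A₃ p q ≡ (J ⊖ IJ) p q + L̄ p q
    twice-A₃ p q = trans (lem (A₃ p q) (A₄ p q)) (cong₂ _+_ (A₃⊕A₄ p q) (sym (L̄≐A₃⊖A₄ p q)))
      where lem : ∀ u v → + 2 * u ≡ (u + v) + (u - v)
            lem = solve-∀

    twice-A₄ : ∀ p q → + 2 * A₄ p q ≡ (J ⊖ IJ) p q - L̄ p q
    twice-A₄ p q = trans (lem (A₃ p q) (A₄ p q)) (cong₂ _-_ (A₃⊕A₄ p q) (sym (L̄≐A₃⊖A₄ p q)))
      where lem : ∀ u v → + 2 * v ≡ (u + v) - (u - v)
            lem = solve-∀

    A₃-in-G : (a - b) ⊙ (J ⊕ ((-1ℤ ⊙ IJ) ⊕ L̄)) ≐ e ⊙ A₃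
    A₃-in-G p q = begin
      (a - b) * (1ℤ + (-1ℤ * IJ p q + L̄ p q)) ≡⟨ cong ((a - b) *_) (lem (IJ p q) (L̄ p q)) ⟩
      (a - b) * ((1ℤ - IJ p q) + L̄ p q)      ≡⟨ cong ((a - b) *_) (twice-A₃ p q) ⟨
      (a - b) * (+ 2 * A₃ p q)                            ≡⟨ lem₂ (a - b) (A₃ p q) ⟩
      e * A₃ p q ∎
      where lem : ∀ u v → 1ℤ + (-1ℤ * u + v) ≡ (1ℤ - u) + v
            lem = solve-∀
            lem₂ : ∀ d u → d * (+ 2 * u) ≡ + 2 * d * u
            lem₂ = solve-∀

    A₄-in-G : (a - b) ⊙ (J ⊕ ((-1ℤ ⊙ IJ) ⊕ (-1ℤ ⊙ L̄))) ≐ e ⊙ A₄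
    A₄-in-G p q = begin
      (a - b) * (1ℤ + (-1ℤ * IJ p q + -1ℤ * L̄ p q)) ≡⟨ cong ((a - b) *_) (lem (IJ p q) (L̄ p q)) ⟩
      (a - b) * ((1ℤ - IJ p q) - L̄ p q)            ≡⟨ cong ((a - b) *_) (twice-A₄ p q) ⟨
      (a - b) * (+ 2 * A₄ p q)                                  ≡⟨ lem₂ (a - b) (A₄ p q) ⟩
      e * A₄ p q ∎
      where lem : ∀ u v → 1ℤ + (-1ℤ * u + -1ℤ * v) ≡ (1ℤ - u) - v
            lem = solve-∀
            lem₂ : ∀ d u → d * (+ 2 * u) ≡ + 2 * d * u
            lem₂ = solve-∀

    𝒜-in-G : ∀ k → InSpan G (e ⊙ 𝒜 k)
    𝒜-in-G 0F = span-⊙ e (span-member 0F)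
    𝒜-in-G 1F = span-≐ A₁-in-G (span-⊙ (+ 2) (span-⊕ (span-member 1F)
                                  (span-⊕ (span-⊙ (b - + ℓ) (span-member 0F)) (span-⊙ (- b) (span-member 2F)))))
    𝒜-in-G 2F = span-≐ A₂-in-G (span-⊕ (span-⊙ e (span-member 2F))
                                  (span-⊕ (span-⊙ -1ℤ (𝒜-in-G 1F)) (span-⊙ (- e) (span-member 0F))))
    𝒜-in-G 3F = span-≐ A₃-in-G (span-⊙ (a - b) (span-⊕ (span-member 3F)
                                  (span-⊕ (span-⊙ -1ℤ (span-member 2F)) (span-member 4F))))
    𝒜-in-G 4F = span-≐ A₄-in-G (span-⊙ (a - b) (span-⊕ (span-member 3F)
                                  (span-⊕ (span-⊙ -1ℤ (span-member 2F)) (span-⊙ -1ℤ (span-member 4F)))))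

    0<ℓ : 0 ℕ.< ℓ
    0<ℓ = ℕP.<-trans (ℕ.s≤s ℕ.z≤n) 1<ℓ

    x₀ : Fin n
    x₀ = fromℕ< (ℕP.<-trans 0<ℓ ℓ<n)

    -- Since S has zero row sums, S is not of the form ℓ I + c (J − I).
    S-not-two-valued : ∀ c → ¬ (∀ y → S x₀ y ≡ + ℓ * I x₀ y + c * (1ℤ - I x₀ y))
    S-not-two-valued c S≡ = affine-row-sum x₀ c 0<ℓ ℓ<n-1
      (trans (sum-cong (λ y → cong (_* 1ℤ) (sym (S≡ y)))) (S-·-J x₀ x₀))

    -- A and Aᶜ are nonzero: otherwise S would be of the form ℓ I + c (J − I).
    A-nonzero : Σ (Fin n) λ x → Σ (Fin n) λ y → A x y ≡ 1ℤ
    A-nonzero with zero-or-one A A-01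
    ... | inj₂ one = one
    ... | inj₁ A≐O = ⊥-elim (S-not-two-valued b λ y →
      trans (S-entries x₀ y) (trans (cong (λ v → + ℓ * I x₀ y + (a * v + b * ((1ℤ - v) - I x₀ y))) (A≐O x₀ y))
                                    (lem (+ ℓ) a b (I x₀ y))))
      where lem : ∀ l a b i → l * i + (a * 0ℤ + b * ((1ℤ - 0ℤ) - i)) ≡ l * i + b * (1ℤ - i)
            lem = solve-∀

    Aᶜ-nonzero : Σ (Fin n) λ x → Σ (Fin n) λ y → Aᶜ x y ≡ 1ℤ
    Aᶜ-nonzero with zero-or-one Aᶜ Aᶜ-01
    ... | inj₂ one = one
    ... | inj₁ Aᶜ≐O = ⊥-elim (S-not-two-valued a λ y →
      trans (S-entries x₀ y) (trans (lem (+ ℓ) a b (I x₀ y) (A x₀ y))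
                                    (trans (cong (λ w → + ℓ * I x₀ y + a * (1ℤ - I x₀ y) + (b - a) * w) (Aᶜ≐O x₀ y))
                                           (lem₂ (+ ℓ * I x₀ y + a * (1ℤ - I x₀ y)) (b - a)))))
      where lem : ∀ l a b i v → l * i + (a * v + b * ((1ℤ - v) - i))
                                 ≡ l * i + a * (1ℤ - i) + (b - a) * ((1ℤ - v) - i)
            lem = solve-∀
            lem₂ : ∀ u d → u + d * 0ℤ ≡ u
            lem₂ = solve-∀

    -- Witnesses: the first and the last block row meet in the entry +1 of L̄.
    first last : Fin (suc ℓ)
    first = zero
    last = Fin.fromℕ ℓ

    last≢first : last ≢ first
    last≢first e = ℕP.<⇒≢ 0<ℓ (sym (trans (sym (FinP.toℕ-fromℕ ℓ)) (cong toℕ e)))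

    p₀ q₀ : Fin N
    p₀ = combine first x₀
    q₀ = combine last x₀

    L̄-p₀q₀ : L̄ p₀ q₀ ≡ 1ℤ
    L̄-p₀q₀ = trans (blk-L̄ first last x₀ x₀)
      (trans (ℤP.*-identityˡ _) (Cℓ-diagonal (L first last) (L-offdiagonal (λ e → last≢first (sym e))) x₀))

    A₃-p₀q₀ : A₃ p₀ q₀ ≡ 1ℤ
    A₃-p₀q₀ = bits-difference-one (A₃-01 p₀ q₀) (A₄-01 p₀ q₀) (trans (sym (L̄≐A₃⊖A₄ p₀ q₀)) L̄-p₀q₀)

    A₄-q₀p₀ : A₄ q₀ p₀ ≡ 1ℤ
    A₄-q₀p₀ = bits-difference-minus-one (A₃-01 q₀ p₀) (A₄-01 q₀ p₀)
      (trans (sym (L̄≐A₃⊖A₄ q₀ p₀)) (trans (L̄-antisymmetric p₀ q₀) (cong -_ L̄-p₀q₀)))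

    𝒜-nonempty : ∀ k → Σ (Fin N) λ x → Σ (Fin N) λ y → 𝒜 k x y ≡ 1ℤ
    𝒜-nonempty 0F = p₀ , p₀ , I-refl p₀
    𝒜-nonempty 1F = let (x , y , Axy≡1) = A-nonzero in
      combine first x , combine first y , trans (blk-IKron A first first x y) (cong₂ _*_ (I-refl first) Axy≡1)
    𝒜-nonempty 2F = let (x , y , Aᶜxy≡1) = Aᶜ-nonzero in
      combine first x , combine first y , trans (blk-IKron Aᶜ first first x y) (cong₂ _*_ (I-refl first) Aᶜxy≡1)
    𝒜-nonempty 3F = p₀ , q₀ , A₃-p₀q₀
    𝒜-nonempty 4F = q₀ , p₀ , A₄-q₀p₀

    -- A₃ and A₄ are transposes of each other, since J − I ⊗ J is symmetric and
    -- L̄ is antisymmetric.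
    A₃ᵀ≐A₄ : A₃ ᵀ ≐ A₄
    A₃ᵀ≐A₄ p q = ℤP.*-cancelˡ-≡ (+ 2) (A₃ q p) (A₄ p q) (begin
      + 2 * A₃ q p
        ≡⟨ twice-A₃ q p ⟩
      (1ℤ - IJ q p) + L̄ q p
        ≡⟨ cong₂ (λ s t → (1ℤ - s) + t) (IKron-symmetric {X = J} (λ _ _ → refl) p q) (L̄-antisymmetric p q) ⟩
      (1ℤ - IJ p q) + - L̄ p q
        ≡⟨ twice-A₄ p q ⟨
      + 2 * A₄ p q ∎)

    𝒜-transpose : ∀ k → Σ (Fin 5) λ k′ → 𝒜 k ᵀ ≐ 𝒜 k′
    𝒜-transpose 0F = 0F , λ x y → I-sym y x
    𝒜-transpose 1F = 1F , IKron-symmetric A-sym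
    𝒜-transpose 2F = 2F , IKron-symmetric Aᶜ-symmetric
    𝒜-transpose 3F = 4F , A₃ᵀ≐A₄
    𝒜-transpose 4F = 3F , λ p q → sym (A₃ᵀ≐A₄ q p)

    A₃+A₄-p₀p₀ : A₃ p₀ p₀ + A₄ p₀ p₀ ≡ 0ℤ
    A₃+A₄-p₀p₀ = trans (A₃⊕A₄ p₀ p₀)
      (cong (_-_ 1ℤ) (trans (blk-IKron J first first x₀ x₀) (cong (_* 1ℤ) (I-refl first))))

    𝒜-diagonal : ∀ (k : Fin 4) → 𝒜 (suc k) p₀ p₀ ≡ 0ℤ
    𝒜-diagonal 0F = trans (blk-IKron A first first x₀ x₀) (cong₂ _*_ (I-refl first) (A-diag x₀))
    𝒜-diagonal 1F = trans (blk-IKron Aᶜ first first x₀ x₀) (cong₂ _*_ (I-refl first) (Aᶜ-diag x₀))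
    𝒜-diagonal 2F = proj₁ (bits-sum-zero₂ (A₃-01 p₀ p₀) (A₄-01 p₀ p₀) A₃+A₄-p₀p₀)
    𝒜-diagonal 3F = proj₂ (bits-sum-zero₂ (A₃-01 p₀ p₀) (A₄-01 p₀ p₀) A₃+A₄-p₀p₀)

    𝒜-not-identity : ∀ (k : Fin 4) → ¬ (𝒜 (suc k) ᵀ ≐ I)
    𝒜-not-identity k 𝒜ᵀ≐I with () ← trans (sym (𝒜-diagonal k)) (trans (𝒜ᵀ≐I p₀ p₀) (I-refl p₀))

    -- The scheme is not symmetric: A₃ᵀ = A₄ is disjoint from A₃ ≠ O.
    A₃-not-symmetric : ¬ Symmetric A₃
    A₃-not-symmetric A₃-sym = A₃A₄-disjoint p₀ q₀
      (A₃-p₀q₀ , trans (sym (A₃ᵀ≐A₄ p₀ q₀)) (trans (A₃-sym p₀ q₀) A₃-p₀q₀))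

    e≢0 : e ≢ 0ℤ
    e≢0 e≡0 with ℤP.i*j≡0⇒i≡0∨j≡0 (+ 2) e≡0
    ... | inj₂ a-b≡0 = a≢b (ℤP.i-j≡0⇒i≡j a b a-b≡0)

    e²≢0 : e * e ≢ 0ℤ
    e²≢0 e²≡0 with ℤP.i*j≡0⇒i≡0∨j≡0 e e²≡0
    ... | inj₁ e≡0 = e≢0 e≡0
    ... | inj₂ e≡0 = e≢0 e≡0

    -- Intersection numbers and commutativity, transported from the generators:
    -- e² Aᵢ Aⱼ = (e Aᵢ)(e Aⱼ) lies in the commutative algebra spanned by G.
    open Partition 𝒜 𝒜-01 𝒜-sum

    intersection-numbers : ∀ i j →
      Σ (Fin 5 → ℕ) λ p → 𝒜 i · 𝒜 j ≐ (λ x y → sumℤ (λ k → (+ p k) * 𝒜 k x y))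
    intersection-numbers i j = natural-coefficients 𝒜-nonempty (e * e) e²≢0 (𝒜 i · 𝒜 j)
      (span-≐ (⊙-·-⊙ e e (𝒜 i) (𝒜 j)) (span-mono G-in-𝒜 (span-· G-closed (𝒜-in-G i) (𝒜-in-G j))))
      (·-natural (𝒜 i) (𝒜 j) (𝒜-01 i) (𝒜-01 j))

    𝒜-commute : ∀ i j → 𝒜 i · 𝒜 j ≐ 𝒜 j · 𝒜 i
    𝒜-commute i j x y = ℤP.*-cancelˡ-≡ (e * e) _ _ {{ℤ.≢-nonZero e²≢0}} (begin
      e * e * (𝒜 i · 𝒜 j) x y    ≡⟨ ⊙-·-⊙ e e (𝒜 i) (𝒜 j) x y ⟨
      ((e ⊙ 𝒜 i) · (e ⊙ 𝒜 j)) x y ≡⟨ span-comm G-commute (𝒜-in-G i) (𝒜-in-G j) x y ⟩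
      ((e ⊙ 𝒜 j) · (e ⊙ 𝒜 i)) x y ≡⟨ ⊙-·-⊙ e e (𝒜 j) (𝒜 i) x y ⟩
      e * e * (𝒜 j · 𝒜 i) x y    ∎)

open import Defs
open import Data.Nat using (ℕ; suc; _<_; _∸_; _*_)
open import Data.Nat.Divisibility using (_∣_)
open import Data.Integer using (ℤ; +_; 0ℤ; 1ℤ)
open import Data.Fin using (Fin; zero; toℕ)
open import Data.Fin.Patterns using (3F)
open import Data.Product using (_×_; _,_)
open import Relation.Binary.PropositionalEquality using (_≡_; _≢_; refl)
open import Relation.Nullary using (¬_)

theorem5p7 : (n ℓ : ℕ) (H : Mat n n) → IsHadamard H
  → ¬ (2 ∣ ℓ) → 1 < ℓ → ℓ < n ∸ 1
  → (a b : ℤ) (A : Mat n n) → a ≢ b → Is01 A → Symmetric A → (∀ x → A x x ≡ 0ℤ)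
  → (λ x y → sumℤ (λ (i : Fin ℓ) → C H (suc (toℕ i)) x y))
      ≐ ((+ ℓ) ⊙ I) ⊕ ((a ⊙ A) ⊕ (b ⊙ ((J ⊖ A) ⊖ I)))
  → (∀ (i : Fin ℓ) → C H (suc (toℕ i)) · J {n} {n} ≐ O)
  → (L : Fin (suc ℓ) → Fin (suc ℓ) → Fin (suc ℓ)) → IsLatinSquare L
  → (∀ i j → L i j ≡ L j i) → (∀ i → L i i ≡ zero)
  → (A₃ A₄ : Mat (suc ℓ * n) (suc ℓ * n)) → Is01 A₃ → Is01 A₄
  → (∀ x y → ¬ (A₃ x y ≡ 1ℤ × A₄ x y ≡ 1ℤ))
  → Lbar H L ≐ A₃ ⊖ A₄
  → IsAssocScheme 4 (fam5 I (IKron (suc ℓ) A) (IKron (suc ℓ) ((J ⊖ A) ⊖ I)) A₃ A₄)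
    × NonSymmetric (fam5 I (IKron (suc ℓ) A) (IKron (suc ℓ) ((J ⊖ A) ⊖ I)) A₃ A₄)
theorem5p7 n ℓ H H-had _ 1<ℓ ℓ<n-1 a b A a≢b A-01 A-sym A-diag S-hyp C-J
           L L-latin L-sym L-diag A₃ A₄ A₃-01 A₄-01 A₃A₄-disjoint L̄≐A₃⊖A₄ =
  ( 𝒜-01 , 𝒜-nonempty , (λ _ _ → refl) , 𝒜-sum , 𝒜-transpose , 𝒜-not-identity
  , intersection-numbers , 𝒜-commute )
  , (3F , A₃-not-symmetric)
  where open Construction.Scheme H H-had 1<ℓ ℓ<n-1 a b A a≢b A-01 A-sym A-diag S-hyp C-J
                                L L-latin L-sym L-diag A₃ A₄ A₃-01 A₄-01 A₃A₄-disjoint L̄≐A₃⊖A₄
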